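{- Let $r\ge2$, $n=2$, $k\ge2$, $m_1=\cdots=m_{r-1}=1$ and $m_r=2(k-1)$. Let $D$ be the distance matrix of the graph $C(2;m_1,\dots,m_r)$. Then $$\det D=(-2)^{r-1}\big[k(k+1)-(r-1)(3k^2-k-2)\big].$$
   Context: $C(n;m_1,\dots,m_r)$ is the undirected, unweighted graph consisting of a path $u_0-u_1-\cdots-u_n$ of length $n$ together with, for each $1\le j\le r$, a path $u_n-v_1^{(j)}-\cdots-v_{m_j}^{(j)}-u_0$ through $m_j$ new vertices; thus it consists of $r$ cycles of lengths $n+m_1+1,\dots,n+m_r+1$, any two of which intersect exactly in the common path. Its distance matrix is $[d(x,y)]$ with $d$ the usual shortest-path distance. -}

module Defs where

open import Data.Nat as ℕ using (ℕ; zero; suc; _≡ᵇ_)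
open import Data.Bool using (Bool; true; false; _∨_; _∧_; if_then_else_)
open import Data.List using (List; []; _∷_; _++_; upTo; allFin)
open import Data.Nat.ListAction using (sum)
open import Data.Bool.ListAction using (any)
open import Data.Product using (_×_; _,_)
open import Data.Fin using (Fin; toℕ; punchIn)
import Data.Fin as F
open import Data.Integer as ℤ using (ℤ; +_; -_)

-- Vertex numbering (as natural numbers < numVertices n ms):
--   u_i            ↦ i                          (0 ≤ i ≤ n)
--   v^{(j)}_i      ↦ n + 1 + (m₁+…+m_{j-1}) + (i - 1)   (1 ≤ i ≤ m_j)

numVertices : ℕ → List ℕ → ℕ
numVertices n ms = suc n ℕ.+ sum ms

pathEdges : List ℕ → List (ℕ × ℕ)
pathEdges (x ∷ y ∷ xs) = (x , y) ∷ pathEdges (y ∷ xs)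
pathEdges _ = []

block : ℕ → ℕ → List ℕ
block off zero = []
block off (suc m) = off ∷ block (suc off) m

branchEdges : ℕ → ℕ → List ℕ → List (ℕ × ℕ)
branchEdges n off [] = []
branchEdges n off (m ∷ ms) =
  pathEdges (n ∷ (block off m ++ (0 ∷ []))) ++ branchEdges n (off ℕ.+ m) ms

edgesC : ℕ → List ℕ → List (ℕ × ℕ)
edgesC n ms = pathEdges (upTo (suc n)) ++ branchEdges n (suc n) ms

adjacent : List (ℕ × ℕ) → ℕ → ℕ → Bool
adjacent es x y =
  any (λ { (a , b) → ((a ≡ᵇ x) ∧ (b ≡ᵇ y)) ∨ ((a ≡ᵇ y) ∧ (b ≡ᵇ x)) }) es

walkWithin : {N : ℕ} → (Fin N → Fin N → Bool) → ℕ → Fin N → Fin N → Bool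
walkWithin adj zero x y = toℕ x ≡ᵇ toℕ y
walkWithin {N} adj (suc ℓ) x y =
  walkWithin adj ℓ x y ∨ any (λ z → adj x z ∧ walkWithin adj ℓ z y) (allFin N)

leastFrom : {N : ℕ} → (Fin N → Fin N → Bool) → ℕ → ℕ → Fin N → Fin N → ℕ
leastFrom adj zero start x y = start
leastFrom adj (suc fuel) start x y =
  if walkWithin adj start x y then start else leastFrom adj fuel (suc start) x y

-- shortest-path distance (any shortest path has length < N in a connected
-- graph on N vertices; for disconnected pairs the value N is returned,
-- which never happens for the connected graphs C(n; ms))
distance : {N : ℕ} → (Fin N → Fin N → Bool) → Fin N → Fin N → ℕ
distance {N} adj x y = leastFrom adj N 0 x y

adjC : (n : ℕ) (ms : List ℕ) → Fin (numVertices n ms) → Fin (numVertices n ms) → Bool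
adjC n ms x y = adjacent (edgesC n ms) (toℕ x) (toℕ y)

distMatrixC : (n : ℕ) (ms : List ℕ) → Fin (numVertices n ms) → Fin (numVertices n ms) → ℤ
distMatrixC n ms x y = + distance (adjC n ms) x y

sumFin : (n : ℕ) → (Fin n → ℤ) → ℤ
sumFin zero f = + 0
sumFin (suc n) f = f F.zero ℤ.+ sumFin n (λ i → f (F.suc i))

det : (n : ℕ) → (Fin n → Fin n → ℤ) → ℤ
det zero A = + 1
det (suc n) A =
  sumFin (suc n) (λ j → ((- + 1) ℤ.^ toℕ j) ℤ.* (A F.zero j ℤ.* det n (λ i k → A (F.suc i) (punchIn j k))))

-- Listing the vertices of the big cycle C_{2k+1} = u₁ u₂ … u₀ in steps of k turns its distance
-- matrix into the Toeplitz matrix T(s,t) = g|s−t| with g(2w) = w and g(2w+1) = k − w. The r−1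
-- one-vertex branches are twins of u₁ (same neighbours u₀, u₂, mutual distance 2); subtracting a
-- twin's row from u₁'s and adding its column back isolates an entry −2, so each twin contributes a
-- factor −2 and changes only u₁'s column, which stays linear in T's column and the unit vector:
--   det D = (−2)^(r−1) [ r·det T_{2k+1} + 2(r−1)·det T_{2k} ].
-- Since g(u) + 2g(u+1) + g(u+2) = 2k+1, elementary row and column operations reduce T to a 2×2
-- determinant, giving det T_{2k+1} = k(k+1) and det T_{2k} = 1 − 2k².
-- The graph distances themselves are identified by checking that the candidate metric vanishes
-- only on the diagonal, grows by at most one along edges and drops by one along some edge.

module Submission where

module Determinant where

  open import Defs
  open import Data.Nat as ℕ using (ℕ; zero; suc)
  open import Data.Fin using (Fin; zero; suc; toℕ; punchIn; punchOut; _≟_)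
  open import Data.Fin.Properties using (suc-injective; punchIn-punchOut; punchOut-injective; punchInᵢ≢i)
  open import Data.Integer using (ℤ; +_; -_; _+_; _*_; _^_)
  import Data.Integer.Properties as ℤP
  open import Data.Integer.Tactic.RingSolver using (solve-∀)
  open import Algebra.Properties.Semiring.Sum ℤP.+-*-semiring
    using (sum; sum-cong-≗; sum-remove; sum-replicate-zero; ∑-comm; ∑-distrib-+; *-distribˡ-sum)
  open import Data.Product using (Σ; _×_; _,_)
  open import Relation.Nullary using (yes; no)
  open import Relation.Nullary.Negation using (contradiction)
  open import Function using (_∘_)
  open import Relation.Binary.PropositionalEquality
  open ≡-Reasoning

  Matrix : ℕ → Set
  Matrix n = Fin n → Fin n → ℤ

  _ᵀ : ∀ {n} → Matrix n → Matrix n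
  (A ᵀ) i j = A j i

  sign : ℕ → ℤ
  sign p = (- + 1) ^ p

  sign-square : ∀ p → sign p * sign p ≡ + 1
  sign-square zero = refl
  sign-square (suc p) = trans (square-neg (sign p)) (sign-square p)
    where
    square-neg : ∀ x → (- + 1 * x) * (- + 1 * x) ≡ x * x
    square-neg = solve-∀

  sign-move : ∀ p {d e} → sign p * d ≡ e → d ≡ sign p * e
  sign-move p {d} {e} eq = begin
    d                       ≡⟨ ℤP.*-identityˡ d ⟨
    + 1 * d                 ≡⟨ cong (_* d) (sign-square p) ⟨
    sign p * sign p * d     ≡⟨ ℤP.*-assoc (sign p) (sign p) d ⟩
    sign p * (sign p * d)   ≡⟨ cong (sign p *_) eq ⟩
    sign p * e              ∎

  minor : ∀ {n} → Matrix (suc n) → Fin (suc n) → Fin (suc n) → Matrix n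
  minor A p q i j = A (punchIn p i) (punchIn q j)

  expansionTerm : ∀ {n} → Matrix (suc n) → Fin (suc n) → Fin (suc n) → ℤ
  expansionTerm {n} A p q = sign (toℕ q) * (A p q * det n (minor A p q))

  sumFin≡sum : ∀ n (f : Fin n → ℤ) → sumFin n f ≡ sum f
  sumFin≡sum zero    f = refl
  sumFin≡sum (suc n) f = cong (_+_ (f zero)) (sumFin≡sum n (λ i → f (suc i)))

  sum-neg : ∀ n (f : Fin n → ℤ) → sum (λ i → - f i) ≡ - sum f
  sum-neg zero    f = refl
  sum-neg (suc n) f = trans (cong (_+_ (- f zero)) (sum-neg n (λ i → f (suc i))))
                            (sym (ℤP.neg-distrib-+ (f zero) (sum (λ i → f (suc i)))))

  sum-single : ∀ n (f : Fin n → ℤ) (q : Fin n) → (∀ j → j ≢ q → f j ≡ + 0) → sum f ≡ f q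
  sum-single (suc n) f q f≡0 = begin
    sum f                                              ≡⟨ sum-remove {i = q} f ⟩
    f q + sum (λ j → f (punchIn q j))                  ≡⟨ cong (_+_ (f q)) (sum-cong-≗ λ j → f≡0 _ (punchInᵢ≢i q j)) ⟩
    f q + sum {n} (λ _ → + 0)                          ≡⟨ cong (_+_ (f q)) (sum-replicate-zero n) ⟩
    f q + + 0                                          ≡⟨ ℤP.+-identityʳ (f q) ⟩
    f q                                                ∎

  det-expandFirstRow : ∀ {n} (A : Matrix (suc n)) → det (suc n) A ≡ sum (expansionTerm A zero)
  det-expandFirstRow {n} A = sumFin≡sum (suc n) (expansionTerm A zero)

  det-cong : ∀ n {A B : Matrix n} → (∀ i j → A i j ≡ B i j) → det n A ≡ det n B
  det-cong zero    A≗B = refl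
  det-cong (suc n) {A} {B} A≗B = begin
    det (suc n) A                ≡⟨ det-expandFirstRow A ⟩
    sum (expansionTerm A zero)   ≡⟨ sum-cong-≗ term≗ ⟩
    sum (expansionTerm B zero)   ≡⟨ det-expandFirstRow B ⟨
    det (suc n) B                ∎
    where
    term≗ : ∀ j → expansionTerm A zero j ≡ expansionTerm B zero j
    term≗ j = cong₂ (λ a d → sign (toℕ j) * (a * d)) (A≗B zero j)
                    (det-cong n (λ x y → A≗B (suc x) (punchIn j y)))

  det-expandFirstColumn : ∀ n (A : Matrix (suc n)) →
    det (suc n) A ≡ sum (λ i → sign (toℕ i) * (A i zero * det n (minor A i zero)))
  det-expandFirstColumn zero    A = refl
  det-expandFirstColumn (suc n) A = trans (det-expandFirstRow A) (cong (_+_ (expansionTerm A zero zero)) (begin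
    sum (λ c → s (suc c) * (a c * det (suc n) (minor A zero (suc c))))
      ≡⟨ sum-cong-≗ (λ c → cong (λ d → s (suc c) * (a c * d)) (det-expandFirstColumn n (minor A zero (suc c)))) ⟩
    sum (λ c → s (suc c) * (a c * sum (λ i → s i * (b i * N i c))))
      ≡⟨ sum-cong-≗ (λ c → *-distribˡ-sum₂ (s (suc c)) (a c) (λ i → s i * (b i * N i c))) ⟩
    sum (λ c → sum (λ i → s (suc c) * (a c * (s i * (b i * N i c)))))
      ≡⟨ sum-cong-≗ (λ c → sum-cong-≗ (λ i → exchange (s c) (a c) (s i) (b i) (N i c))) ⟩
    sum (λ c → sum (λ i → s (suc i) * (b i * (s c * (a c * N i c)))))
      ≡⟨ ∑-comm (λ c i → s (suc i) * (b i * (s c * (a c * N i c)))) ⟩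
    sum (λ i → sum (λ c → s (suc i) * (b i * (s c * (a c * N i c)))))
      ≡⟨ sum-cong-≗ (λ i → *-distribˡ-sum₂ (s (suc i)) (b i) (λ c → s c * (a c * N i c))) ⟨
    sum (λ i → s (suc i) * (b i * sum (λ c → s c * (a c * N i c))))
      ≡⟨ sum-cong-≗ (λ i → cong (λ d → s (suc i) * (b i * d)) (det-expandFirstRow (minor A (suc i) zero))) ⟨
    sum (λ i → s (suc i) * (b i * det (suc n) (minor A (suc i) zero))) ∎))
    where
    s : ∀ {m} → Fin m → ℤ
    s i = sign (toℕ i)
    a b : Fin (suc n) → ℤ
    a c = A zero (suc c)
    b i = A (suc i) zero
    N : Fin (suc n) → Fin (suc n) → ℤ
    N i c = det n (λ x y → A (suc (punchIn i x)) (suc (punchIn c y)))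
    *-distribˡ-sum₂ : ∀ {m} x y (f : Fin m → ℤ) → x * (y * sum f) ≡ sum (λ i → x * (y * f i))
    *-distribˡ-sum₂ x y f = trans (cong (x *_) (*-distribˡ-sum y f)) (*-distribˡ-sum x (λ i → y * f i))
    exchange : ∀ sc ac si bi d → (- + 1 * sc) * (ac * (si * (bi * d))) ≡ (- + 1 * si) * (bi * (sc * (ac * d)))
    exchange = solve-∀

  det-transpose : ∀ n (A : Matrix n) → det n (A ᵀ) ≡ det n A
  det-transpose zero    A = refl
  det-transpose (suc n) A = begin
    det (suc n) (A ᵀ)
      ≡⟨ det-expandFirstRow (A ᵀ) ⟩
    sum (expansionTerm (A ᵀ) zero)
      ≡⟨ sum-cong-≗ (λ i → cong (λ d → sign (toℕ i) * (A i zero * d)) (det-transpose n (minor A i zero))) ⟩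
    sum (λ i → sign (toℕ i) * (A i zero * det n (minor A i zero)))
      ≡⟨ det-expandFirstColumn n A ⟨
    det (suc n) A ∎

  swap₀₁ : ∀ {n} → Fin (suc (suc n)) → Fin (suc (suc n))
  swap₀₁ zero          = suc zero
  swap₀₁ (suc zero)    = zero
  swap₀₁ (suc (suc i)) = suc (suc i)

  -- The first two expansion terms trade places; every other minor has its first two columns swapped.
  mutual
    det-swapFirstColumns : ∀ n (A : Matrix (suc (suc n))) →
      det (suc (suc n)) (λ i j → A i (swap₀₁ j)) ≡ - det (suc (suc n)) A
    det-swapFirstColumns n A = begin
      det (suc (suc n)) A′
        ≡⟨ det-expandFirstRow A′ ⟩
      + 1 * (A zero (suc zero) * det (suc n) (minor A′ zero zero))
        + (- + 1 * (A zero zero * det (suc n) (minor A′ zero (suc zero))) + sum (λ c → expansionTerm A′ zero (suc (suc c))))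
        ≡⟨ cong₃ (λ u v w → + 1 * (A zero (suc zero) * u) + (- + 1 * (A zero zero * v) + w))
                 (det-cong (suc n) minor₀) (det-cong (suc n) minor₁)
                 (trans (sum-cong-≗ (trailingTerms-swapFirstColumns n A)) (sum-neg n _)) ⟩
      + 1 * (A zero (suc zero) * d₁) + (- + 1 * (A zero zero * d₀) + - rest)
        ≡⟨ regroup (A zero (suc zero)) d₁ (A zero zero) d₀ rest ⟩
      - (+ 1 * (A zero zero * d₀) + (- + 1 * (A zero (suc zero) * d₁) + rest))
        ≡⟨ cong -_ (det-expandFirstRow A) ⟨
      - det (suc (suc n)) A ∎
      where
      A′ : Matrix (suc (suc n))
      A′ i j = A i (swap₀₁ j)
      d₀ d₁ rest : ℤ
      d₀ = det (suc n) (minor A zero zero)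
      d₁ = det (suc n) (minor A zero (suc zero))
      rest = sum (λ c → expansionTerm A zero (suc (suc c)))
      minor₀ : ∀ i j → minor A′ zero zero i j ≡ minor A zero (suc zero) i j
      minor₀ i zero    = refl
      minor₀ i (suc j) = refl
      minor₁ : ∀ i j → minor A′ zero (suc zero) i j ≡ minor A zero zero i j
      minor₁ i zero    = refl
      minor₁ i (suc j) = refl
      cong₃ : ∀ {x x′ y y′ z z′ : ℤ} (f : ℤ → ℤ → ℤ → ℤ) → x ≡ x′ → y ≡ y′ → z ≡ z′ → f x y z ≡ f x′ y′ z′
      cong₃ f refl refl refl = refl
      regroup : ∀ a d₁ b d₀ r → + 1 * (a * d₁) + (- + 1 * (b * d₀) + - r) ≡ - (+ 1 * (b * d₀) + (- + 1 * (a * d₁) + r))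
      regroup = solve-∀

    trailingTerms-swapFirstColumns : ∀ n (A : Matrix (suc (suc n))) (c : Fin n) →
      expansionTerm (λ i j → A i (swap₀₁ j)) zero (suc (suc c)) ≡ - expansionTerm A zero (suc (suc c))
    trailingTerms-swapFirstColumns (suc n) A c = trans
      (cong (λ d → sign (toℕ (suc (suc c))) * (A zero (suc (suc c)) * d))
            (trans (det-cong (suc (suc n)) minor-swapped) (det-swapFirstColumns n (minor A zero (suc (suc c))))))
      (negate-term (sign (toℕ (suc (suc c)))) (A zero (suc (suc c))) _)
      where
      minor-swapped : ∀ i j → minor (λ x y → A x (swap₀₁ y)) zero (suc (suc c)) i j
                            ≡ minor A zero (suc (suc c)) i (swap₀₁ j)
      minor-swapped i zero                = refl
      minor-swapped i (suc zero)          = refl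
      minor-swapped i (suc (suc j))       = refl
      negate-term : ∀ s a d → s * (a * - d) ≡ - (s * (a * d))
      negate-term = solve-∀

  det-swapFirstRows : ∀ n (A : Matrix (suc (suc n))) →
    det (suc (suc n)) (λ i j → A (swap₀₁ i) j) ≡ - det (suc (suc n)) A
  det-swapFirstRows n A = begin
    det (suc (suc n)) (λ i j → A (swap₀₁ i) j)   ≡⟨ det-transpose _ (λ i j → A (swap₀₁ i) j) ⟨
    det (suc (suc n)) (λ i j → A (swap₀₁ j) i)   ≡⟨ det-swapFirstColumns n (A ᵀ) ⟩
    - det (suc (suc n)) (A ᵀ)                        ≡⟨ cong -_ (det-transpose _ A) ⟩
    - det (suc (suc n)) A                            ∎

  cycleTo : ∀ {n} → Fin (suc n) → Fin (suc n) → Fin (suc n)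
  cycleTo p zero    = p
  cycleTo p (suc i) = punchIn p i

  det-cycleRows : ∀ n (p : Fin (suc n)) (A : Matrix (suc n)) →
    det (suc n) (λ i j → A (cycleTo p i) j) ≡ sign (toℕ p) * det (suc n) A
  det-cycleRows n zero A = trans (det-cong (suc n) unchanged) (sym (ℤP.*-identityˡ _))
    where
    unchanged : ∀ i j → A (cycleTo zero i) j ≡ A i j
    unchanged zero    j = refl
    unchanged (suc i) j = refl
  det-cycleRows (suc n) (suc p) A = begin
    det (suc (suc n)) (λ i j → A (cycleTo (suc p) i) j)   ≡⟨ det-cong (suc (suc n)) swapped ⟩
    det (suc (suc n)) (λ i j → B (swap₀₁ i) j)       ≡⟨ det-swapFirstRows n B ⟩
    - det (suc (suc n)) B                                 ≡⟨ cong -_ det-B ⟩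
    - (sign (toℕ p) * det (suc (suc n)) A)                ≡⟨ neg-sign (sign (toℕ p)) _ ⟩
    sign (toℕ (suc p)) * det (suc (suc n)) A              ∎
    where
    B : Matrix (suc (suc n))
    B zero    j = A zero j
    B (suc i) j = A (suc (cycleTo p i)) j
    swapped : ∀ i j → A (cycleTo (suc p) i) j ≡ B (swap₀₁ i) j
    swapped zero          j = refl
    swapped (suc zero)    j = refl
    swapped (suc (suc i)) j = refl
    pull : ∀ s a e d → s * (a * (e * d)) ≡ e * (s * (a * d))
    pull = solve-∀
    neg-sign : ∀ s x → - (s * x) ≡ (- + 1 * s) * x
    neg-sign = solve-∀
    det-B : det (suc (suc n)) B ≡ sign (toℕ p) * det (suc (suc n)) A
    det-B = begin
      det (suc (suc n)) B
        ≡⟨ det-expandFirstRow B ⟩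
      sum (expansionTerm B zero)
        ≡⟨ sum-cong-≗ (λ j → trans (cong (λ d → sign (toℕ j) * (A zero j * d)) (det-cycleRows n p (minor A zero j)))
                                   (pull (sign (toℕ j)) (A zero j) (sign (toℕ p)) _)) ⟩
      sum (λ j → sign (toℕ p) * expansionTerm A zero j)
        ≡⟨ *-distribˡ-sum (sign (toℕ p)) (expansionTerm A zero) ⟨
      sign (toℕ p) * sum (expansionTerm A zero)
        ≡⟨ cong (sign (toℕ p) *_) (det-expandFirstRow A) ⟨
      sign (toℕ p) * det (suc (suc n)) A ∎

  det-expandRow : ∀ n (p : Fin (suc n)) (A : Matrix (suc n)) →
    det (suc n) A ≡ sign (toℕ p) * sum (expansionTerm A p)
  det-expandRow n p A = sign-move (toℕ p)
    (trans (sym (det-cycleRows n p A)) (det-expandFirstRow (λ i j → A (cycleTo p i) j)))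

  det-rowLinear : ∀ n (q : Fin n) (c : ℤ) {A B C : Matrix n} →
    (∀ i j → i ≢ q → C i j ≡ A i j) → (∀ i j → i ≢ q → B i j ≡ A i j) →
    (∀ j → C q j ≡ A q j + c * B q j) → det n C ≡ det n A + c * det n B
  det-rowLinear (suc n) q c {A} {B} {C} C≗A B≗A Cq = begin
    det (suc n) C
      ≡⟨ det-expandRow n q C ⟩
    sign (toℕ q) * sum (expansionTerm C q)
      ≡⟨ cong (sign (toℕ q) *_) (sum-cong-≗ splitTerm) ⟩
    sign (toℕ q) * sum (λ j → expansionTerm A q j + c * expansionTerm B q j)
      ≡⟨ cong (sign (toℕ q) *_) (trans (∑-distrib-+ (expansionTerm A q) (λ j → c * expansionTerm B q j))
                                       (cong (_+_ (sum (expansionTerm A q))) (sym (*-distribˡ-sum c (expansionTerm B q))))) ⟩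
    sign (toℕ q) * (sum (expansionTerm A q) + c * sum (expansionTerm B q))
      ≡⟨ distribute (sign (toℕ q)) _ c _ ⟩
    sign (toℕ q) * sum (expansionTerm A q) + c * (sign (toℕ q) * sum (expansionTerm B q))
      ≡⟨ cong₂ (λ a b → a + c * b) (det-expandRow n q A) (det-expandRow n q B) ⟨
    det (suc n) A + c * det (suc n) B ∎
    where
    minorC≡minorA : ∀ j → det n (minor C q j) ≡ det n (minor A q j)
    minorC≡minorA j = det-cong n (λ x y → C≗A _ _ (punchInᵢ≢i q x))
    minorB≡minorA : ∀ j → det n (minor B q j) ≡ det n (minor A q j)
    minorB≡minorA j = det-cong n (λ x y → B≗A _ _ (punchInᵢ≢i q x))
    expand : ∀ s a c b d → s * ((a + c * b) * d) ≡ s * (a * d) + c * (s * (b * d))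
    expand = solve-∀
    distribute : ∀ s x c y → s * (x + c * y) ≡ s * x + c * (s * y)
    distribute = solve-∀
    splitTerm : ∀ j → expansionTerm C q j ≡ expansionTerm A q j + c * expansionTerm B q j
    splitTerm j = begin
      sign (toℕ j) * (C q j * det n (minor C q j))
        ≡⟨ cong₂ (λ x d → sign (toℕ j) * (x * d)) (Cq j) (minorC≡minorA j) ⟩
      sign (toℕ j) * ((A q j + c * B q j) * det n (minor A q j))
        ≡⟨ expand (sign (toℕ j)) (A q j) c (B q j) _ ⟩
      expansionTerm A q j + c * (sign (toℕ j) * (B q j * det n (minor A q j)))
        ≡⟨ cong (λ d → expansionTerm A q j + c * (sign (toℕ j) * (B q j * d))) (minorB≡minorA j) ⟨
      expansionTerm A q j + c * expansionTerm B q j ∎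

  det-zeroRow : ∀ n (A : Matrix n) (q : Fin n) → (∀ j → A q j ≡ + 0) → det n A ≡ + 0
  det-zeroRow (suc n) A q Aq≡0 = begin
    det (suc n) A                              ≡⟨ det-expandRow n q A ⟩
    sign (toℕ q) * sum (expansionTerm A q)     ≡⟨ cong (sign (toℕ q) *_) (sum-cong-≗ zeroTerm) ⟩
    sign (toℕ q) * sum {suc n} (λ _ → + 0)     ≡⟨ cong (sign (toℕ q) *_) (sum-replicate-zero (suc n)) ⟩
    sign (toℕ q) * + 0                         ≡⟨ ℤP.*-zeroʳ (sign (toℕ q)) ⟩
    + 0                                        ∎
    where
    zeroTerm : ∀ j → expansionTerm A q j ≡ + 0
    zeroTerm j = trans (cong (λ a → sign (toℕ j) * (a * det n (minor A q j))) (Aq≡0 j))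
                       (ℤP.*-zeroʳ (sign (toℕ j)))

  det-singleEntryRow : ∀ n (A : Matrix (suc n)) (p q : Fin (suc n)) → (∀ j → j ≢ q → A p j ≡ + 0) →
    det (suc n) A ≡ sign (toℕ p) * (sign (toℕ q) * (A p q * det n (minor A p q)))
  det-singleEntryRow n A p q Ap≡0 = trans (det-expandRow n p A)
    (cong (sign (toℕ p) *_) (sum-single (suc n) (expansionTerm A p) q zeroTerm))
    where
    zeroTerm : ∀ j → j ≢ q → expansionTerm A p j ≡ + 0
    zeroTerm j j≢q = trans (cong (λ a → sign (toℕ j) * (a * det n (minor A p j))) (Ap≡0 j j≢q))
                           (ℤP.*-zeroʳ (sign (toℕ j)))

  x≡-x⇒x≡0 : ∀ {x} → x ≡ - x → x ≡ + 0
  x≡-x⇒x≡0 {+ zero} _ = refl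

  sign-cancel-zero : ∀ p {d} → sign p * d ≡ + 0 → d ≡ + 0
  sign-cancel-zero p {d} eq = trans (sign-move p eq) (ℤP.*-zeroʳ (sign p))

  det-equalFirstRows : ∀ n (A : Matrix (suc (suc n))) → (∀ k → A zero k ≡ A (suc zero) k) → det (suc (suc n)) A ≡ + 0
  det-equalFirstRows n A A₀≡A₁ = x≡-x⇒x≡0 (trans (det-cong (suc (suc n)) swap-invariant) (det-swapFirstRows n A))
    where
    swap-invariant : ∀ i j → A i j ≡ A (swap₀₁ i) j
    swap-invariant zero          j = A₀≡A₁ j
    swap-invariant (suc zero)    j = sym (A₀≡A₁ j)
    swap-invariant (suc (suc i)) j = refl

  det-equalRows : ∀ n (A : Matrix n) {i j : Fin n} → i ≢ j → (∀ k → A i k ≡ A j k) → det n A ≡ + 0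
  det-equalRows (suc n) A {i} {j} i≢j Ai≡Aj =
    sign-cancel-zero (toℕ j) (trans (sym (det-cycleRows n j A)) (equalRow₀ n B (punchOut j≢i) B₀≡B))
    where
    j≢i : j ≢ i
    j≢i = i≢j ∘ sym
    B : Matrix (suc n)
    B x y = A (cycleTo j x) y
    B₀≡B : ∀ k → B zero k ≡ B (suc (punchOut j≢i)) k
    B₀≡B k = trans (sym (Ai≡Aj k)) (cong (λ r → A r k) (sym (punchIn-punchOut j≢i)))
    equalRow₀ : ∀ m (M : Matrix (suc m)) (x : Fin m) → (∀ k → M zero k ≡ M (suc x) k) → det (suc m) M ≡ + 0
    equalRow₀ (suc m) M x M₀≡M =
      sign-cancel-zero (toℕ (suc x))
        (trans (sym (det-cycleRows (suc m) (suc x) M)) (det-equalFirstRows m (λ y z → M (cycleTo (suc x) y) z) (λ k → sym (M₀≡M k))))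

  det-rowOperation : ∀ n {A C : Matrix n} {i j : Fin n} (c : ℤ) → i ≢ j →
    (∀ x y → x ≢ i → C x y ≡ A x y) → (∀ y → C i y ≡ A i y + c * A j y) → det n C ≡ det n A
  det-rowOperation n {A} {C} {i} {j} c i≢j C≗A Ci = begin
    det n C                   ≡⟨ det-rowLinear n i c C≗A B≗A (λ y → trans (Ci y) (cong (λ b → A i y + c * b) (sym (Bi y)))) ⟩
    det n A + c * det n B     ≡⟨ cong (λ d → det n A + c * d) (det-equalRows n B i≢j (λ k → trans (Bi k) (sym (B≗A j k (i≢j ∘ sym))))) ⟩
    det n A + c * + 0         ≡⟨ cong (_+_ (det n A)) (ℤP.*-zeroʳ c) ⟩
    det n A + + 0             ≡⟨ ℤP.+-identityʳ (det n A) ⟩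
    det n A                   ∎
    where
    B : Matrix n
    B x y with x ≟ i
    ... | yes _ = A j y
    ... | no  _ = A x y
    B≗A : ∀ x y → x ≢ i → B x y ≡ A x y
    B≗A x y x≢i with x ≟ i
    ... | yes x≡i = contradiction x≡i x≢i
    ... | no  _   = refl
    Bi : ∀ y → B i y ≡ A j y
    Bi y with i ≟ i
    ... | yes _   = refl
    ... | no  i≢i = contradiction refl i≢i

  PermutationSign : ∀ n → (Fin n → Fin n) → ℤ → Set
  PermutationSign n σ e = (e * e ≡ + 1) × (∀ A → det n (λ i j → A (σ i) j) ≡ e * det n A)

  det-permuteRows : ∀ n (σ : Fin n → Fin n) → (∀ {a b} → σ a ≡ σ b → a ≡ b) → Σ ℤ (PermutationSign n σ)
  det-permuteRows zero    σ σ-inj = + 1 , refl , λ A → refl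
  det-permuteRows (suc n) σ σ-inj = extend (det-permuteRows n ρ ρ-inj)
    where
    p : Fin (suc n)
    p = σ zero
    p≢σsuc : ∀ i → p ≢ σ (suc i)
    p≢σsuc i eq with σ-inj eq
    ... | ()
    ρ : Fin n → Fin n
    ρ i = punchOut (p≢σsuc i)
    ρ-inj : ∀ {a b} → ρ a ≡ ρ b → a ≡ b
    ρ-inj eq = suc-injective (σ-inj (punchOut-injective (p≢σsuc _) (p≢σsuc _) eq))
    regroup : ∀ a b → a * b * (a * b) ≡ (a * a) * (b * b)
    regroup = solve-∀
    pull : ∀ s a e d → s * (a * (e * d)) ≡ e * (s * (a * d))
    pull = solve-∀
    extend : Σ ℤ (PermutationSign n ρ) → Σ ℤ (PermutationSign (suc n) σ)
    extend (e , e² , det-ρ) = e * sign (toℕ p) , trans (regroup e (sign (toℕ p))) (cong₂ _*_ e² (sign-square (toℕ p))) , permuted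
      where
      permuted : ∀ A → det (suc n) (λ i j → A (σ i) j) ≡ e * sign (toℕ p) * det (suc n) A
      permuted A = begin
        det (suc n) (λ i j → A (σ i) j)
          ≡⟨ det-expandFirstRow (λ i j → A (σ i) j) ⟩
        sum (λ j → sign (toℕ j) * (A p j * det n (λ x y → A (σ (suc x)) (punchIn j y))))
          ≡⟨ sum-cong-≗ (λ j → cong (λ d → sign (toℕ j) * (A p j * d))
                                    (det-cong n (λ x y → cong (λ r → A r (punchIn j y)) (sym (punchIn-punchOut (p≢σsuc x)))))) ⟩
        sum (λ j → sign (toℕ j) * (A p j * det n (λ x y → minor A p j (ρ x) y)))
          ≡⟨ sum-cong-≗ (λ j → trans (cong (λ d → sign (toℕ j) * (A p j * d)) (det-ρ (minor A p j)))
                                     (pull (sign (toℕ j)) (A p j) e _)) ⟩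
        sum (λ j → e * expansionTerm A p j)
          ≡⟨ *-distribˡ-sum e (expansionTerm A p) ⟨
        e * sum (expansionTerm A p)
          ≡⟨ cong (e *_) (sign-move (toℕ p) (sym (det-expandRow n p A))) ⟩
        e * (sign (toℕ p) * det (suc n) A)
          ≡⟨ ℤP.*-assoc e (sign (toℕ p)) _ ⟨
        e * sign (toℕ p) * det (suc n) A ∎

  det-conjugate : ∀ n (σ : Fin n → Fin n) → (∀ {a b} → σ a ≡ σ b → a ≡ b) →
    ∀ (A : Matrix n) → det n (λ i j → A (σ i) (σ j)) ≡ det n A
  det-conjugate n σ σ-inj A with det-permuteRows n σ σ-inj
  ... | e , e² , det-σ = begin
    det n (λ i j → A (σ i) (σ j))       ≡⟨ det-σ (λ i j → A i (σ j)) ⟩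
    e * det n (λ i j → A i (σ j))       ≡⟨ cong (e *_) (det-transpose n (λ i j → A i (σ j))) ⟨
    e * det n (λ i j → A j (σ i))       ≡⟨ cong (e *_) (det-σ (A ᵀ)) ⟩
    e * (e * det n (A ᵀ))               ≡⟨ cong (λ d → e * (e * d)) (det-transpose n A) ⟩
    e * (e * det n A)                   ≡⟨ ℤP.*-assoc e e _ ⟨
    e * e * det n A                     ≡⟨ cong (_* det n A) e² ⟩
    + 1 * det n A                       ≡⟨ ℤP.*-identityˡ _ ⟩
    det n A                             ∎

  det-columnLinear : ∀ n (q : Fin n) (c : ℤ) {A B C : Matrix n} →
    (∀ i j → j ≢ q → C i j ≡ A i j) → (∀ i j → j ≢ q → B i j ≡ A i j) →
    (∀ i → C i q ≡ A i q + c * B i q) → det n C ≡ det n A + c * det n B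
  det-columnLinear n q c {A} {B} {C} C≗A B≗A Cq = begin
    det n C                               ≡⟨ det-transpose n C ⟨
    det n (C ᵀ)                           ≡⟨ det-rowLinear n q c (λ i j → C≗A j i) (λ i j → B≗A j i) Cq ⟩
    det n (A ᵀ) + c * det n (B ᵀ)         ≡⟨ cong₂ (λ a b → a + c * b) (det-transpose n A) (det-transpose n B) ⟩
    det n A + c * det n B                 ∎

  det-columnOperation : ∀ n {A C : Matrix n} {i j : Fin n} (c : ℤ) → i ≢ j →
    (∀ x y → y ≢ i → C x y ≡ A x y) → (∀ x → C x i ≡ A x i + c * A x j) → det n C ≡ det n A
  det-columnOperation n {A} {C} c i≢j C≗A Ci = begin
    det n C         ≡⟨ det-transpose n C ⟨
    det n (C ᵀ)     ≡⟨ det-rowOperation n c i≢j (λ x y → C≗A y x) Ci ⟩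
    det n (A ᵀ)     ≡⟨ det-transpose n A ⟩
    det n A         ∎

  det-zeroColumn : ∀ n (A : Matrix n) (q : Fin n) → (∀ i → A i q ≡ + 0) → det n A ≡ + 0
  det-zeroColumn n A q Aq≡0 = trans (sym (det-transpose n A)) (det-zeroRow n (A ᵀ) q Aq≡0)

  det-singleEntryColumn : ∀ n (A : Matrix (suc n)) (p q : Fin (suc n)) → (∀ i → i ≢ p → A i q ≡ + 0) →
    det (suc n) A ≡ sign (toℕ q) * (sign (toℕ p) * (A p q * det n (minor A p q)))
  det-singleEntryColumn n A p q Aq≡0 = begin
    det (suc n) A
      ≡⟨ det-transpose (suc n) A ⟨
    det (suc n) (A ᵀ)
      ≡⟨ det-singleEntryRow n (A ᵀ) q p Aq≡0 ⟩
    sign (toℕ q) * (sign (toℕ p) * (A p q * det n (minor A p q ᵀ)))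
      ≡⟨ cong (λ d → sign (toℕ q) * (sign (toℕ p) * (A p q * d))) (det-transpose n (minor A p q)) ⟩
    sign (toℕ q) * (sign (toℕ p) * (A p q * det n (minor A p q))) ∎

module IndexedDeterminant where

  open import Defs
  open Determinant
  open import Data.Nat as ℕ using (ℕ; zero; suc; _<_; s≤s)
  open import Data.Fin using (Fin; zero; suc; toℕ; fromℕ<; punchIn)
  open import Data.Fin.Properties using (toℕ<n; toℕ-fromℕ<; toℕ-injective)
  open import Data.Integer using (ℤ; +_; _+_; _*_)
  import Data.Integer.Properties as ℤP
  import Data.Nat.Properties as ℕP
  open import Function using (_∘_)
  open import Relation.Nullary using (yes; no)
  open import Relation.Nullary.Negation using (contradiction)
  open import Relation.Binary.PropositionalEquality
  open ≡-Reasoning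

  toMatrix : ∀ n → (ℕ → ℕ → ℤ) → Matrix n
  toMatrix n f i j = f (toℕ i) (toℕ j)

  detℕ : ℕ → (ℕ → ℕ → ℤ) → ℤ
  detℕ n f = det n (toMatrix n f)

  punchInℕ : ℕ → ℕ → ℕ
  punchInℕ zero    x       = suc x
  punchInℕ (suc p) zero    = zero
  punchInℕ (suc p) (suc x) = suc (punchInℕ p x)

  toℕ-punchIn : ∀ {n} (i : Fin (suc n)) (j : Fin n) → toℕ (punchIn i j) ≡ punchInℕ (toℕ i) (toℕ j)
  toℕ-punchIn zero    j       = refl
  toℕ-punchIn (suc i) zero    = refl
  toℕ-punchIn (suc i) (suc j) = cong suc (toℕ-punchIn i j)

  punchInℕ-below : ∀ p x → x < p → punchInℕ p x ≡ x
  punchInℕ-below (suc p) zero    _         = refl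
  punchInℕ-below (suc p) (suc x) (s≤s x<p) = cong suc (punchInℕ-below p x x<p)

  detℕ-cong : ∀ n {f g : ℕ → ℕ → ℤ} → (∀ x y → x < n → y < n → f x y ≡ g x y) → detℕ n f ≡ detℕ n g
  detℕ-cong n f≗g = det-cong n (λ i j → f≗g (toℕ i) (toℕ j) (toℕ<n i) (toℕ<n j))

  δ : ℕ → ℕ → ℤ
  δ zero    zero    = + 1
  δ zero    (suc q) = + 0
  δ (suc t) zero    = + 0
  δ (suc t) (suc q) = δ t q

  δ-refl : ∀ t → δ t t ≡ + 1
  δ-refl zero    = refl
  δ-refl (suc t) = δ-refl t

  δ-≢ : ∀ {t q} → t ≢ q → δ t q ≡ + 0
  δ-≢ {zero}  {zero}  t≢q = contradiction refl t≢q
  δ-≢ {zero}  {suc q} t≢q = refl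
  δ-≢ {suc t} {zero}  t≢q = refl
  δ-≢ {suc t} {suc q} t≢q = δ-≢ (t≢q ∘ cong suc)

  updateRow : ℕ → (ℕ → ℤ) → (ℕ → ℕ → ℤ) → ℕ → ℕ → ℤ
  updateRow i r f s t with s ℕ.≟ i
  ... | yes _ = r t
  ... | no  _ = f s t

  updateRow-≡ : ∀ i r f t → updateRow i r f i t ≡ r t
  updateRow-≡ i r f t with i ℕ.≟ i
  ... | yes _   = refl
  ... | no  i≢i = contradiction refl i≢i

  updateRow-≢ : ∀ i r f {s} t → s ≢ i → updateRow i r f s t ≡ f s t
  updateRow-≢ i r f {s} t s≢i with s ℕ.≟ i
  ... | yes s≡i = contradiction s≡i s≢i
  ... | no  _   = refl

  updateColumn : ℕ → (ℕ → ℤ) → (ℕ → ℕ → ℤ) → ℕ → ℕ → ℤ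
  updateColumn j r f s t with t ℕ.≟ j
  ... | yes _ = r s
  ... | no  _ = f s t

  updateColumn-≡ : ∀ j r f s → updateColumn j r f s j ≡ r s
  updateColumn-≡ j r f s with j ℕ.≟ j
  ... | yes _   = refl
  ... | no  j≢j = contradiction refl j≢j

  updateColumn-≢ : ∀ j r f s {t} → t ≢ j → updateColumn j r f s t ≡ f s t
  updateColumn-≢ j r f s {t} t≢j with t ℕ.≟ j
  ... | yes t≡j = contradiction t≡j t≢j
  ... | no  _   = refl

  private
    toℕ≢ : ∀ {n} (x : Fin n) {i} (i<n : i < n) → x ≢ fromℕ< i<n → toℕ x ≢ i
    toℕ≢ x i<n x≢i eq = x≢i (toℕ-injective (trans eq (sym (toℕ-fromℕ< i<n))))

    fromℕ<-≢ : ∀ {n i j} (i<n : i < n) (j<n : j < n) → i ≢ j → fromℕ< i<n ≢ fromℕ< j<n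
    fromℕ<-≢ i<n j<n i≢j eq = i≢j (trans (sym (toℕ-fromℕ< i<n)) (trans (cong toℕ eq) (toℕ-fromℕ< j<n)))

    at-fromℕ< : ∀ {n i} (i<n : i < n) (P : ℕ → Set) → P i → P (toℕ (fromℕ< i<n))
    at-fromℕ< i<n P = subst P (sym (toℕ-fromℕ< i<n))

  detℕ-rowOperation : ∀ n (f h : ℕ → ℕ → ℤ) (i j : ℕ) (c : ℤ) → i < n → j < n → i ≢ j →
    (∀ x y → x < n → y < n → x ≢ i → h x y ≡ f x y) → (∀ y → y < n → h i y ≡ f i y + c * f j y) →
    detℕ n h ≡ detℕ n f
  detℕ-rowOperation n f h i j c i<n j<n i≢j h≗f hi =
    det-rowOperation n c (fromℕ<-≢ i<n j<n i≢j)
      (λ x y x≢i → h≗f (toℕ x) (toℕ y) (toℕ<n x) (toℕ<n y) (toℕ≢ x i<n x≢i))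
      (λ y → at-fromℕ< i<n (λ i′ → h i′ (toℕ y) ≡ f i′ (toℕ y) + c * f (toℕ (fromℕ< j<n)) (toℕ y))
               (at-fromℕ< j<n (λ j′ → h i (toℕ y) ≡ f i (toℕ y) + c * f j′ (toℕ y)) (hi (toℕ y) (toℕ<n y))))

  detℕ-transpose : ∀ n (f : ℕ → ℕ → ℤ) → detℕ n (λ x y → f y x) ≡ detℕ n f
  detℕ-transpose n f = det-transpose n (toMatrix n f)

  detℕ-columnOperation : ∀ n (f h : ℕ → ℕ → ℤ) (i j : ℕ) (c : ℤ) → i < n → j < n → i ≢ j →
    (∀ x y → x < n → y < n → y ≢ i → h x y ≡ f x y) → (∀ x → x < n → h x i ≡ f x i + c * f x j) →
    detℕ n h ≡ detℕ n f
  detℕ-columnOperation n f h i j c i<n j<n i≢j h≗f hi = begin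
    detℕ n h                   ≡⟨ detℕ-transpose n h ⟨
    detℕ n (λ x y → h y x)     ≡⟨ detℕ-rowOperation n (λ x y → f y x) (λ x y → h y x) i j c i<n j<n i≢j
                                     (λ x y x<n y<n → h≗f y x y<n x<n) hi ⟩
    detℕ n (λ x y → f y x)     ≡⟨ detℕ-transpose n f ⟩
    detℕ n f                   ∎

  detℕ-addRow : ∀ n (f : ℕ → ℕ → ℤ) (i j : ℕ) (c : ℤ) → i < n → j < n → i ≢ j →
    detℕ n (updateRow i (λ y → f i y + c * f j y) f) ≡ detℕ n f
  detℕ-addRow n f i j c i<n j<n i≢j =
    detℕ-rowOperation n f _ i j c i<n j<n i≢j (λ x y _ _ → updateRow-≢ i _ f y) (λ y _ → updateRow-≡ i _ f y)

  detℕ-addColumn : ∀ n (f : ℕ → ℕ → ℤ) (i j : ℕ) (c : ℤ) → i < n → j < n → i ≢ j →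
    detℕ n (updateColumn i (λ x → f x i + c * f x j) f) ≡ detℕ n f
  detℕ-addColumn n f i j c i<n j<n i≢j =
    detℕ-columnOperation n f _ i j c i<n j<n i≢j (λ x y _ _ → updateColumn-≢ i _ f x) (λ x _ → updateColumn-≡ i _ f x)

  detℕ-rowOperation₂ : ∀ n (f h : ℕ → ℕ → ℤ) (i j k : ℕ) (a b : ℤ) → i < n → j < n → k < n → i ≢ j → i ≢ k →
    (∀ x y → x < n → y < n → x ≢ i → h x y ≡ f x y) → (∀ y → y < n → h i y ≡ f i y + a * f j y + b * f k y) →
    detℕ n h ≡ detℕ n f
  detℕ-rowOperation₂ n f h i j k a b i<n j<n k<n i≢j i≢k h≗f hi =
    trans (detℕ-rowOperation n g h i k b i<n k<n i≢k h≗g hi′) (detℕ-addRow n f i j a i<n j<n i≢j)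
    where
    g : ℕ → ℕ → ℤ
    g = updateRow i (λ y → f i y + a * f j y) f
    h≗g : ∀ x y → x < n → y < n → x ≢ i → h x y ≡ g x y
    h≗g x y x<n y<n x≢i = trans (h≗f x y x<n y<n x≢i) (sym (updateRow-≢ i _ f y x≢i))
    hi′ : ∀ y → y < n → h i y ≡ g i y + b * g k y
    hi′ y y<n = trans (hi y y<n) (cong₂ (λ u v → u + b * v) (sym (updateRow-≡ i _ f y)) (sym (updateRow-≢ i _ f y (i≢k ∘ sym))))

  detℕ-singleEntryRow : ∀ n (f : ℕ → ℕ → ℤ) (p q : ℕ) → p < suc n → q < suc n →
    (∀ y → y < suc n → y ≢ q → f p y ≡ + 0) →
    detℕ (suc n) f ≡ sign p * (sign q * (f p q * detℕ n (λ x y → f (punchInℕ p x) (punchInℕ q y))))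
  detℕ-singleEntryRow n f p q p<n q<n fp≡0 = begin
    detℕ (suc n) f
      ≡⟨ det-singleEntryRow n (toMatrix (suc n) f) p′ q′
           (λ j j≢q → at-fromℕ< p<n (λ r → f r (toℕ j) ≡ + 0) (fp≡0 (toℕ j) (toℕ<n j) (toℕ≢ j q<n j≢q))) ⟩
    sign (toℕ p′) * (sign (toℕ q′) * (f (toℕ p′) (toℕ q′) * det n (minor (toMatrix (suc n) f) p′ q′)))
      ≡⟨ cong₂ (λ u v → sign u * (sign v * (f u v * det n (minor (toMatrix (suc n) f) p′ q′)))) (toℕ-fromℕ< p<n) (toℕ-fromℕ< q<n) ⟩
    sign p * (sign q * (f p q * det n (minor (toMatrix (suc n) f) p′ q′)))
      ≡⟨ cong (λ d → sign p * (sign q * (f p q * d))) (det-cong n punched) ⟩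
    sign p * (sign q * (f p q * detℕ n (λ x y → f (punchInℕ p x) (punchInℕ q y)))) ∎
    where
    p′ q′ : Fin (suc n)
    p′ = fromℕ< p<n
    q′ = fromℕ< q<n
    punched : ∀ i j → minor (toMatrix (suc n) f) p′ q′ i j ≡ f (punchInℕ p (toℕ i)) (punchInℕ q (toℕ j))
    punched i j = cong₂ f (trans (toℕ-punchIn p′ i) (cong (λ r → punchInℕ r (toℕ i)) (toℕ-fromℕ< p<n)))
                          (trans (toℕ-punchIn q′ j) (cong (λ r → punchInℕ r (toℕ j)) (toℕ-fromℕ< q<n)))

  detℕ-singleEntryColumn : ∀ n (f : ℕ → ℕ → ℤ) (p q : ℕ) → p < suc n → q < suc n →
    (∀ x → x < suc n → x ≢ p → f x q ≡ + 0) →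
    detℕ (suc n) f ≡ sign q * (sign p * (f p q * detℕ n (λ x y → f (punchInℕ p x) (punchInℕ q y))))
  detℕ-singleEntryColumn n f p q p<n q<n fq≡0 = begin
    detℕ (suc n) f
      ≡⟨ detℕ-transpose (suc n) f ⟨
    detℕ (suc n) (λ x y → f y x)
      ≡⟨ detℕ-singleEntryRow n (λ x y → f y x) q p q<n p<n fq≡0 ⟩
    sign q * (sign p * (f p q * detℕ n (λ x y → f (punchInℕ p y) (punchInℕ q x))))
      ≡⟨ cong (λ d → sign q * (sign p * (f p q * d))) (detℕ-transpose n (λ x y → f (punchInℕ p x) (punchInℕ q y))) ⟩
    sign q * (sign p * (f p q * detℕ n (λ x y → f (punchInℕ p x) (punchInℕ q y)))) ∎

  detℕ-columnLinear : ∀ n (f g h : ℕ → ℕ → ℤ) (q : ℕ) (c : ℤ) → q < n →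
    (∀ x y → x < n → y < n → y ≢ q → h x y ≡ f x y) → (∀ x y → x < n → y < n → y ≢ q → g x y ≡ f x y) →
    (∀ x → x < n → h x q ≡ f x q + c * g x q) → detℕ n h ≡ detℕ n f + c * detℕ n g
  detℕ-columnLinear n f g h q c q<n h≗f g≗f hq =
    det-columnLinear n (fromℕ< q<n) c
      (λ i j j≢q → h≗f (toℕ i) (toℕ j) (toℕ<n i) (toℕ<n j) (toℕ≢ j q<n j≢q))
      (λ i j j≢q → g≗f (toℕ i) (toℕ j) (toℕ<n i) (toℕ<n j) (toℕ≢ j q<n j≢q))
      (λ i → at-fromℕ< q<n (λ r → h (toℕ i) r ≡ f (toℕ i) r + c * g (toℕ i) r) (hq (toℕ i) (toℕ<n i)))

  detℕ-zeroColumn : ∀ n (f : ℕ → ℕ → ℤ) (q : ℕ) → q < n → (∀ x → x < n → f x q ≡ + 0) → detℕ n f ≡ + 0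
  detℕ-zeroColumn n f q q<n fq≡0 =
    det-zeroColumn n (toMatrix n f) (fromℕ< q<n) (λ i → at-fromℕ< q<n (λ r → f (toℕ i) r ≡ + 0) (fq≡0 (toℕ i) (toℕ<n i)))

  detℕ-scaleColumn : ∀ n (f : ℕ → ℕ → ℤ) (q : ℕ) (a : ℤ) → q < n →
    detℕ n (updateColumn q (λ x → a * f x q) f) ≡ a * detℕ n f
  detℕ-scaleColumn n f q a q<n = begin
    detℕ n (updateColumn q (λ x → a * f x q) f)   ≡⟨ detℕ-columnLinear n Z f _ q a q<n h≗Z f≗Z hq ⟩
    detℕ n Z + a * detℕ n f                       ≡⟨ cong (_+ a * detℕ n f) (detℕ-zeroColumn n Z q q<n (λ x _ → updateColumn-≡ q _ f x)) ⟩
    + 0 + a * detℕ n f                            ≡⟨ ℤP.+-identityˡ _ ⟩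
    a * detℕ n f                                  ∎
    where
    Z : ℕ → ℕ → ℤ
    Z = updateColumn q (λ _ → + 0) f
    h≗Z : ∀ x y → x < n → y < n → y ≢ q → updateColumn q (λ x → a * f x q) f x y ≡ Z x y
    h≗Z x y _ _ y≢q = trans (updateColumn-≢ q _ f x y≢q) (sym (updateColumn-≢ q _ f x y≢q))
    f≗Z : ∀ x y → x < n → y < n → y ≢ q → f x y ≡ Z x y
    f≗Z x y _ _ y≢q = sym (updateColumn-≢ q _ f x y≢q)
    hq : ∀ x → x < n → updateColumn q (λ x → a * f x q) f x q ≡ Z x q + a * f x q
    hq x _ = trans (updateColumn-≡ q _ f x)
                   (trans (sym (ℤP.+-identityˡ _)) (cong (_+ a * f x q) (sym (updateColumn-≡ q _ f x))))

  detℕ-unitLastColumn : ∀ c (f : ℕ → ℕ → ℤ) → detℕ (suc c) (updateColumn c (λ x → δ x c) f) ≡ detℕ c f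
  detℕ-unitLastColumn c f = begin
    detℕ (suc c) E
      ≡⟨ detℕ-singleEntryColumn c E c c (ℕP.n<1+n c) (ℕP.n<1+n c)
           (λ x _ x≢c → trans (updateColumn-≡ c _ f x) (δ-≢ x≢c)) ⟩
    sign c * (sign c * (E c c * detℕ c (λ x y → E (punchInℕ c x) (punchInℕ c y))))
      ≡⟨ cong₂ (λ u v → sign c * (sign c * (u * v))) (trans (updateColumn-≡ c _ f c) (δ-refl c)) (detℕ-cong c leading) ⟩
    sign c * (sign c * (+ 1 * detℕ c f))
      ≡⟨ cong (sign c *_) (cong (sign c *_) (ℤP.*-identityˡ _)) ⟩
    sign c * (sign c * detℕ c f)
      ≡⟨ sign-move c refl ⟨
    detℕ c f ∎
    where
    E : ℕ → ℕ → ℤ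
    E = updateColumn c (λ x → δ x c) f
    leading : ∀ x y → x < c → y < c → E (punchInℕ c x) (punchInℕ c y) ≡ f x y
    leading x y x<c y<c = trans (cong₂ E (punchInℕ-below c x x<c) (punchInℕ-below c y y<c))
                                (updateColumn-≢ c _ f x (ℕP.<⇒≢ y<c))

module CycleMatrixDeterminant where

  open import Defs
  open Determinant
  open IndexedDeterminant
  open import Data.Nat as ℕ using (ℕ; zero; suc; _<_; _≤_; z≤n; s≤s; ∣_-_∣)
  import Data.Nat.Properties as ℕP
  open import Data.Integer using (ℤ; +_; -_; _+_; _*_; _-_)
  import Data.Integer.Properties as ℤP
  open import Data.Integer.Tactic.RingSolver using (solve-∀)
  open import Data.Sum using (_⊎_; inj₁; inj₂)
  open import Function using (_∘_)
  open import Relation.Nullary using (yes; no)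
  open import Relation.Nullary.Negation using (contradiction)
  open import Relation.Binary.PropositionalEquality
  open ≡-Reasoning

  double : ℕ → ℕ
  double zero    = zero
  double (suc w) = suc (suc (double w))

  double≡+ : ∀ w → double w ≡ w ℕ.+ w
  double≡+ zero    = refl
  double≡+ (suc w) = cong suc (trans (cong suc (double≡+ w)) (sym (ℕP.+-suc w w)))

  sign-double : ∀ w → sign (double w) ≡ + 1
  sign-double zero    = refl
  sign-double (suc w) = trans (twice-neg (sign (double w))) (sign-double w)
    where
    twice-neg : ∀ x → - + 1 * (- + 1 * x) ≡ x
    twice-neg = solve-∀

  cycleLength : ℕ → ℕ
  cycleLength k = suc (k ℕ.+ k)

  -- On the cycle of length 2k+1, the vertices u·k and 0 (mod 2k+1) are at distance cycDist k u.
  cycDist : ℕ → ℕ → ℤ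
  cycDist k zero          = + 0
  cycDist k (suc zero)    = + k
  cycDist k (suc (suc u)) = cycDist k u + sign u

  cycDist-even : ∀ k w → cycDist k (double w) ≡ + w
  cycDist-even k zero    = refl
  cycDist-even k (suc w) = trans (cong₂ _+_ (cycDist-even k w) (sign-double w)) (ℤP.+-comm (+ w) (+ 1))

  cycDist-odd : ∀ k w → cycDist k (suc (double w)) ≡ + k - + w
  cycDist-odd k zero    = sym (ℤP.+-identityʳ (+ k))
  cycDist-odd k (suc w) = trans (cong₂ _+_ (cycDist-odd k w) (cong (- + 1 *_) (sign-double w))) (step (+ k) (+ w))
    where
    step : ∀ a b → a - b + - + 1 * + 1 ≡ a - (+ 1 + b)
    step = solve-∀

  cycDist-smoothing : ∀ k u → cycDist k u + + 2 * cycDist k (suc u) + cycDist k (suc (suc u)) ≡ + cycleLength k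
  cycDist-smoothing k zero                = base (+ k)
    where
    base : ∀ a → + 0 + + 2 * a + (+ 0 + + 1) ≡ + 1 + (a + a)
    base = solve-∀
  cycDist-smoothing k (suc zero)          = base (+ k)
    where
    base : ∀ a → a + + 2 * (+ 0 + + 1) + (a + - + 1 * + 1) ≡ + 1 + (a + a)
    base = solve-∀
  cycDist-smoothing k (suc (suc u)) = trans (shift (cycDist k u) (cycDist k (suc u)) (cycDist k (suc (suc u))) (sign u))
                                            (cycDist-smoothing k u)
    where
    shift : ∀ a b c s → (a + s) + + 2 * (b + - + 1 * s) + (c + - + 1 * (- + 1 * s)) ≡ a + + 2 * b + c
    shift = solve-∀

  cycleMatrix : ℕ → ℕ → ℕ → ℤ
  cycleMatrix k s t = cycDist k ∣ s - t ∣

  cycleMatrix-rowCombination : ∀ k s t →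
    cycleMatrix k s t + + 2 * cycleMatrix k (suc s) t + cycleMatrix k (suc (suc s)) t ≡ + cycleLength k - δ t (suc s)
  cycleMatrix-rowCombination k zero          zero          = trans (cycDist-smoothing k 0) (sym (ℤP.+-identityʳ _))
  cycleMatrix-rowCombination k (suc s)       zero          = trans (cycDist-smoothing k (suc s)) (sym (ℤP.+-identityʳ _))
  cycleMatrix-rowCombination k zero          (suc zero)    = around (+ k)
    where
    around : ∀ a → a + + 2 * + 0 + a ≡ + 1 + (a + a) - + 1
    around = solve-∀
  cycleMatrix-rowCombination k zero          (suc (suc t)) =
    trans (reverse (cycDist k (suc (suc t))) (cycDist k (suc t)) (cycDist k t))
          (trans (cycDist-smoothing k t) (sym (ℤP.+-identityʳ _)))
    where
    reverse : ∀ a b c → a + + 2 * b + c ≡ c + + 2 * b + a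
    reverse = solve-∀
  cycleMatrix-rowCombination k (suc s)       (suc t)       = cycleMatrix-rowCombination k s t

  detℕ-staircase : ∀ p (f : ℕ → ℕ → ℤ) → (∀ s t → s < p → t < suc (suc p) → f s t ≡ - δ t (suc s)) →
    detℕ (suc (suc p)) f ≡ f p 0 * f (suc p) (suc p) - f p (suc p) * f (suc p) 0
  detℕ-staircase zero    f _ = expand2×2 (f 0 0) (f 0 1) (f 1 0) (f 1 1)
    where
    -- the normal form of det 2 (toMatrix 2 f) under the Laplace expansion of Defs
    expand2×2 : ∀ a b c d → + 1 * (a * (+ 1 * (d * + 1) + + 0)) + ((- + 1 * + 1) * (b * (+ 1 * (c * + 1) + + 0)) + + 0)
                          ≡ a * d - b * c
    expand2×2 = solve-∀
  detℕ-staircase (suc p) f f-upper = begin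
    detℕ (suc (suc (suc p))) f
      ≡⟨ detℕ-singleEntryRow (suc (suc p)) f 0 1 (s≤s z≤n) (s≤s (s≤s z≤n)) row₀ ⟩
    sign 0 * (sign 1 * (f 0 1 * detℕ (suc (suc p)) f′))
      ≡⟨ cong (λ a → sign 0 * (sign 1 * (a * detℕ (suc (suc p)) f′))) (f-upper 0 1 (s≤s z≤n) (s≤s (s≤s z≤n))) ⟩
    + 1 * ((- + 1 * + 1) * (- + 1 * detℕ (suc (suc p)) f′))
      ≡⟨ signs (detℕ (suc (suc p)) f′) ⟩
    detℕ (suc (suc p)) f′
      ≡⟨ detℕ-staircase p f′ f′-upper ⟩
    f (suc p) 0 * f (suc (suc p)) (suc (suc p)) - f (suc p) (suc (suc p)) * f (suc (suc p)) 0 ∎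
    where
    f′ : ℕ → ℕ → ℤ
    f′ x y = f (punchInℕ 0 x) (punchInℕ 1 y)
    row₀ : ∀ y → y < suc (suc (suc p)) → y ≢ 1 → f 0 y ≡ + 0
    row₀ y y< y≢1 = trans (f-upper 0 y (s≤s z≤n) y<) (cong -_ (δ-≢ y≢1))
    signs : ∀ d → + 1 * ((- + 1 * + 1) * (- + 1 * d)) ≡ d
    signs = solve-∀
    punchIn₁< : ∀ t → t < suc (suc p) → punchInℕ 1 t < suc (suc (suc p))
    punchIn₁< zero    _       = s≤s z≤n
    punchIn₁< (suc t) (s≤s t<) = s≤s (s≤s t<)
    δ-punchIn₁ : ∀ t s → δ (punchInℕ 1 t) (suc (suc s)) ≡ δ t (suc s)
    δ-punchIn₁ zero    s = refl
    δ-punchIn₁ (suc t) s = refl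
    f′-upper : ∀ s t → s < p → t < suc (suc p) → f′ s t ≡ - δ t (suc s)
    f′-upper s t s<p t< = trans (f-upper (suc s) (punchInℕ 1 t) (s≤s s<p) (punchIn₁< t t<)) (cong -_ (δ-punchIn₁ t s))

  <⊎≥ : ∀ x j → (x < j) ⊎ (j ≤ x)
  <⊎≥ x j with x ℕ.<? j
  ... | yes x<j = inj₁ x<j
  ... | no  x≮j = inj₂ (ℕP.≮⇒≥ x≮j)

  -- Adding 2·(row s+1) + (row s+2) to row s turns it into (2k+1) − e_{s+1} (cycleMatrix-rowCombination);
  -- subtracting column 0 from the others and then clearing column 0 leaves −e_{s+1} in the rows s < M.
  module CycleMatrixReduction (k M : ℕ) where

    m : ℕ
    m = suc (suc M)

    ℓ : ℤ
    ℓ = + cycleLength k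

    T : ℕ → ℕ → ℤ
    T = cycleMatrix k

    combinedRow : ℕ → ℕ → ℤ
    combinedRow s t = ℓ - δ t (suc s)

    rowsCombined : ℕ → ℕ → ℕ → ℤ
    rowsCombined j s t with s ℕ.<? j
    ... | yes _ = combinedRow s t
    ... | no  _ = T s t

    rowsCombined-< : ∀ j s t → s < j → rowsCombined j s t ≡ combinedRow s t
    rowsCombined-< j s t s<j with s ℕ.<? j
    ... | yes _   = refl
    ... | no  s≮j = contradiction s<j s≮j

    rowsCombined-≥ : ∀ j s t → j ≤ s → rowsCombined j s t ≡ T s t
    rowsCombined-≥ j s t j≤s with s ℕ.<? j
    ... | yes s<j = contradiction j≤s (ℕP.<⇒≱ s<j)
    ... | no  _   = refl

    det-rowsCombined : ∀ j → suc (suc j) ≤ m → detℕ m (rowsCombined j) ≡ detℕ m T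
    det-rowsCombined zero    _   = detℕ-cong m (λ x y _ _ → rowsCombined-≥ 0 x y z≤n)
    det-rowsCombined (suc j) j+2<m = trans
      (detℕ-rowOperation₂ m (rowsCombined j) (rowsCombined (suc j)) j (suc j) (suc (suc j)) (+ 2) (+ 1)
        j<m j+1<m j+2<m (ℕP.<⇒≢ (ℕP.n<1+n j)) (ℕP.<⇒≢ (ℕP.m<n+m j (s≤s z≤n))) other rowj)
      (det-rowsCombined j (ℕP.≤-trans (ℕP.n≤1+n _) j+2<m))
      where
      j+1<m : suc j < m
      j+1<m = ℕP.<-trans (ℕP.n<1+n _) j+2<m
      j<m : j < m
      j<m = ℕP.<-trans (ℕP.n<1+n _) j+1<m
      other : ∀ x y → x < m → y < m → x ≢ j → rowsCombined (suc j) x y ≡ rowsCombined j x y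
      other x y _ _ x≢j with <⊎≥ x j
      ... | inj₁ x<j = trans (rowsCombined-< (suc j) x y (ℕP.m<n⇒m<1+n x<j)) (sym (rowsCombined-< j x y x<j))
      ... | inj₂ j≤x = trans (rowsCombined-≥ (suc j) x y (ℕP.≤∧≢⇒< j≤x (x≢j ∘ sym))) (sym (rowsCombined-≥ j x y j≤x))
      rowj : ∀ y → y < m → rowsCombined (suc j) j y
                         ≡ rowsCombined j j y + + 2 * rowsCombined j (suc j) y + + 1 * rowsCombined j (suc (suc j)) y
      rowj y _ = begin
        rowsCombined (suc j) j y
          ≡⟨ rowsCombined-< (suc j) j y (ℕP.n<1+n j) ⟩
        combinedRow j y
          ≡⟨ cycleMatrix-rowCombination k j y ⟨
        T j y + + 2 * T (suc j) y + T (suc (suc j)) y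
          ≡⟨ cong₂ (λ a b → a + + 2 * b + T (suc (suc j)) y)
                   (sym (rowsCombined-≥ j j y ℕP.≤-refl)) (sym (rowsCombined-≥ j (suc j) y (ℕP.n≤1+n j))) ⟩
        rowsCombined j j y + + 2 * rowsCombined j (suc j) y + T (suc (suc j)) y
          ≡⟨ cong (_+_ (rowsCombined j j y + + 2 * rowsCombined j (suc j) y))
                  (trans (sym (ℤP.*-identityˡ _)) (cong (+ 1 *_) (sym (rowsCombined-≥ j (suc (suc j)) y (ℕP.m≤n+m j 2))))) ⟩
        rowsCombined j j y + + 2 * rowsCombined j (suc j) y + + 1 * rowsCombined j (suc (suc j)) y ∎

    S : ℕ → ℕ → ℤ
    S = rowsCombined M

    columnsReduced : ℕ → ℕ → ℕ → ℤ
    columnsReduced j s zero    = S s 0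
    columnsReduced j s (suc t) with suc t ℕ.≤? j
    ... | yes _ = S s (suc t) - S s 0
    ... | no  _ = S s (suc t)

    columnsReduced-≤ : ∀ j s t → suc t ≤ j → columnsReduced j s (suc t) ≡ S s (suc t) - S s 0
    columnsReduced-≤ j s t t<j with suc t ℕ.≤? j
    ... | yes _   = refl
    ... | no  t≮j = contradiction t<j t≮j

    columnsReduced-> : ∀ j s t → j < suc t → columnsReduced j s (suc t) ≡ S s (suc t)
    columnsReduced-> j s t j≤t with suc t ℕ.≤? j
    ... | yes t<j = contradiction t<j (ℕP.<⇒≱ j≤t)
    ... | no  _   = refl

    det-columnsReduced : ∀ j → j ≤ suc M → detℕ m (columnsReduced j) ≡ detℕ m S
    det-columnsReduced zero    _ = detℕ-cong m unchanged
      where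
      unchanged : ∀ x y → x < m → y < m → columnsReduced 0 x y ≡ S x y
      unchanged x zero    _ _ = refl
      unchanged x (suc y) _ _ = columnsReduced-> 0 x y (s≤s z≤n)
    det-columnsReduced (suc j) j<M+1 = trans
      (detℕ-columnOperation m (columnsReduced j) (columnsReduced (suc j)) (suc j) 0 (- + 1) (s≤s j<M+1) (s≤s z≤n) (λ ())
        other columnj)
      (det-columnsReduced j (ℕP.≤-trans (ℕP.n≤1+n j) j<M+1))
      where
      other : ∀ x y → x < m → y < m → y ≢ suc j → columnsReduced (suc j) x y ≡ columnsReduced j x y
      other x zero    _ _ _ = refl
      other x (suc t) _ _ t≢j with <⊎≥ j (suc t)
      ... | inj₁ j<t+1 = trans (columnsReduced-> (suc j) x t (ℕP.≤∧≢⇒< j<t+1 (t≢j ∘ sym))) (sym (columnsReduced-> j x t j<t+1))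
      ... | inj₂ t<j   = trans (columnsReduced-≤ (suc j) x t (ℕP.≤-trans t<j (ℕP.n≤1+n j))) (sym (columnsReduced-≤ j x t t<j))
      subtract : ∀ a b → a - b ≡ a + - + 1 * b
      subtract = solve-∀
      columnj : ∀ x → x < m → columnsReduced (suc j) x (suc j) ≡ columnsReduced j x (suc j) + - + 1 * columnsReduced j x 0
      columnj x _ = trans (columnsReduced-≤ (suc j) x j ℕP.≤-refl)
        (trans (subtract (S x (suc j)) (S x 0)) (cong (λ a → a + - + 1 * S x 0) (sym (columnsReduced-> j x j (ℕP.n<1+n j)))))

    W : ℕ → ℕ → ℤ
    W = columnsReduced (suc M)

    sweptColumn : ℕ → ℕ → ℤ
    sweptColumn zero    s = W s 0
    sweptColumn (suc j) s = sweptColumn j s + ℓ * W s (suc j)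

    swept : ℕ → ℕ → ℕ → ℤ
    swept j s zero    = sweptColumn j s
    swept j s (suc t) = W s (suc t)

    det-swept : ∀ j → j ≤ M → detℕ m (swept j) ≡ detℕ m W
    det-swept zero    _ = detℕ-cong m unchanged
      where
      unchanged : ∀ x y → x < m → y < m → swept 0 x y ≡ W x y
      unchanged x zero    _ _ = refl
      unchanged x (suc y) _ _ = refl
    det-swept (suc j) j<M = trans
      (detℕ-columnOperation m (swept j) (swept (suc j)) 0 (suc j) ℓ (s≤s z≤n) (ℕP.≤-trans (s≤s j<M) (ℕP.n≤1+n _)) (λ ())
        other (λ x _ → refl))
      (det-swept j (ℕP.≤-trans (ℕP.n≤1+n j) j<M))
      where
      other : ∀ x y → x < m → y < m → y ≢ 0 → swept (suc j) x y ≡ swept j x y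
      other x zero    _ _ y≢0 = contradiction refl y≢0
      other x (suc t) _ _ _   = refl

    W-upper : ∀ s t → s < M → suc t ≤ suc M → W s (suc t) ≡ - δ (suc t) (suc s)
    W-upper s t s<M t≤M = trans (columnsReduced-≤ (suc M) s t t≤M)
      (trans (cong₂ _-_ (rowsCombined-< M s (suc t) s<M) (rowsCombined-< M s 0 s<M)) (cancel ℓ (δ (suc t) (suc s))))
      where
      cancel : ∀ a b → (a - b) - (a - + 0) ≡ - b
      cancel = solve-∀

    sweptColumn-upper-≥ : ∀ j s → s < M → j ≤ s → sweptColumn j s ≡ ℓ
    sweptColumn-upper-≥ zero    s s<M _   = trans (rowsCombined-< M s 0 s<M) (ℤP.+-identityʳ ℓ)
    sweptColumn-upper-≥ (suc j) s s<M j<s = trans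
      (cong₂ (λ u v → u + ℓ * v) (sweptColumn-upper-≥ j s s<M (ℕP.≤-trans (ℕP.n≤1+n j) j<s))
        (trans (W-upper s j s<M (ℕP.≤-trans j<s (ℕP.≤-trans (ℕP.<⇒≤ s<M) (ℕP.n≤1+n M)))) (cong -_ (δ-≢ (ℕP.<⇒≢ j<s)))))
      (unchanged ℓ)
      where
      unchanged : ∀ a → a + a * - + 0 ≡ a
      unchanged = solve-∀

    sweptColumn-upper-< : ∀ j s → s < M → s < j → j ≤ M → sweptColumn j s ≡ + 0
    sweptColumn-upper-< (suc j) s s<M s<j+1 j<M with <⊎≥ s j
    ... | inj₁ s<j = trans
      (cong₂ (λ u v → u + ℓ * v) (sweptColumn-upper-< j s s<M s<j (ℕP.≤-trans (ℕP.n≤1+n j) j<M))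
        (trans W-s (cong -_ (δ-≢ (ℕP.<⇒≢ s<j ∘ sym)))))
      (vanish ℓ)
      where
      W-s : W s (suc j) ≡ - δ (suc j) (suc s)
      W-s = W-upper s j s<M (ℕP.≤-trans j<M (ℕP.n≤1+n M))
      vanish : ∀ a → + 0 + a * - + 0 ≡ + 0
      vanish = solve-∀
    ... | inj₂ j≤s = trans
      (cong₂ (λ u v → u + ℓ * v) (sweptColumn-upper-≥ j s s<M j≤s)
        (trans (W-upper s j s<M (ℕP.≤-trans j<M (ℕP.n≤1+n M))) (cong -_ (trans (cong (λ z → δ (suc z) (suc s)) j≡s) (δ-refl s)))))
      (vanish ℓ)
      where
      j≡s : j ≡ s
      j≡s = ℕP.≤-antisym j≤s (ℕP.≤-pred s<j+1)
      vanish : ∀ a → a + a * - + 1 ≡ + 0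
      vanish = solve-∀

    rowPrefix : ℕ → ℕ → ℤ
    rowPrefix x zero    = + 0
    rowPrefix x (suc j) = rowPrefix x j + T x (suc j)

    W-lower : ∀ x t → M ≤ x → suc t ≤ suc M → W x (suc t) ≡ T x (suc t) - T x 0
    W-lower x t M≤x t≤M = trans (columnsReduced-≤ (suc M) x t t≤M)
      (cong₂ _-_ (rowsCombined-≥ M x (suc t) M≤x) (rowsCombined-≥ M x 0 M≤x))

    sweptColumn-lower : ∀ j x → M ≤ x → j ≤ M → sweptColumn j x ≡ T x 0 + ℓ * (rowPrefix x j - + j * T x 0)
    sweptColumn-lower zero    x M≤x _ = trans (rowsCombined-≥ M x 0 M≤x) (no-sum (T x 0) ℓ)
      where
      no-sum : ∀ a c → a ≡ a + c * (+ 0 - + 0 * a)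
      no-sum = solve-∀
    sweptColumn-lower (suc j) x M≤x j<M = trans
      (cong₂ (λ u v → u + ℓ * v) (sweptColumn-lower j x M≤x (ℕP.≤-trans (ℕP.n≤1+n j) j<M))
        (W-lower x j M≤x (ℕP.≤-trans j<M (ℕP.n≤1+n M))))
      (accumulate ℓ (T x 0) (rowPrefix x j) (T x (suc j)) (+ j))
      where
      accumulate : ∀ c a p t j → (a + c * (p - j * a)) + c * (t - a) ≡ a + c * ((p + t) - (+ 1 + j) * a)
      accumulate = solve-∀

    det-2×2 : detℕ m T ≡ swept M M 0 * swept M (suc M) (suc M) - swept M M (suc M) * swept M (suc M) 0
    det-2×2 = begin
      detℕ m T              ≡⟨ det-rowsCombined M ℕP.≤-refl ⟨
      detℕ m S              ≡⟨ det-columnsReduced (suc M) ℕP.≤-refl ⟨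
      detℕ m W              ≡⟨ det-swept M ℕP.≤-refl ⟨
      detℕ m (swept M)      ≡⟨ detℕ-staircase M (swept M) upper ⟩
      swept M M 0 * swept M (suc M) (suc M) - swept M M (suc M) * swept M (suc M) 0 ∎
      where
      upper : ∀ s t → s < M → t < m → swept M s t ≡ - δ t (suc s)
      upper s zero    s<M _        = sweptColumn-upper-< M s s<M s<M ℕP.≤-refl
      upper s (suc t) s<M (s≤s t<) = W-upper s t s<M t<

  cycDistSum : ℕ → ℕ → ℤ
  cycDistSum k zero    = + 0
  cycDistSum k (suc u) = cycDistSum k u + cycDist k u

  cycDistSum-even : ∀ k w → cycDistSum k (double w) ≡ + w * + k
  cycDistSum-odd  : ∀ k w → cycDistSum k (suc (double w)) ≡ + w * + k + + w
  cycDistSum-even k zero    = refl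
  cycDistSum-even k (suc w) = trans (cong₂ _+_ (cycDistSum-odd k w) (cycDist-odd k w)) (collect (+ w) (+ k))
    where
    collect : ∀ w k → w * k + w + (k - w) ≡ (+ 1 + w) * k
    collect = solve-∀
  cycDistSum-odd  k w       = cong₂ _+_ (cycDistSum-even k w) (cycDist-even k w)

  rowPrefix-closed : ∀ k M j d →
    CycleMatrixReduction.rowPrefix k M (j ℕ.+ d) j + cycDistSum k d ≡ cycDistSum k (j ℕ.+ d)
  rowPrefix-closed k M zero    d = ℤP.+-identityˡ _
  rowPrefix-closed k M (suc j) d = begin
    P (suc (j ℕ.+ d)) j + cycDist k ∣ j ℕ.+ d - j ∣ + cycDistSum k d
      ≡⟨ cong (λ u → P (suc (j ℕ.+ d)) j + cycDist k u + cycDistSum k d) (trans (ℕP.∣-∣-comm (j ℕ.+ d) j) (ℕP.∣m-m+n∣≡n j d)) ⟩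
    P (suc (j ℕ.+ d)) j + cycDist k d + cycDistSum k d
      ≡⟨ swap-last (P (suc (j ℕ.+ d)) j) (cycDist k d) (cycDistSum k d) ⟩
    P (suc (j ℕ.+ d)) j + cycDistSum k (suc d)
      ≡⟨ subst (λ z → P z j + cycDistSum k (suc d) ≡ cycDistSum k z) (ℕP.+-suc j d) (rowPrefix-closed k M j (suc d)) ⟩
    cycDistSum k (suc (j ℕ.+ d)) ∎
    where
    P : ℕ → ℕ → ℤ
    P = CycleMatrixReduction.rowPrefix k M
    swap-last : ∀ a b c → a + b + c ≡ a + (c + b)
    swap-last = solve-∀

  twoByTwo : (k M g₀ g₁ G₀ G₁ : ℤ) → ℤ
  twoByTwo k M g₀ g₁ G₀ G₁ = (g₀ + ℓ * (G₀ - M * g₀)) * (+ 0 - g₁) - (k - g₀) * (g₁ + ℓ * (G₁ - M * g₁))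
    where
    ℓ : ℤ
    ℓ = + 1 + (k + k)

  twoByTwo-cong : ∀ k {M M′ g₀ g₀′ g₁ g₁′ G₀ G₀′ G₁ G₁′} → M ≡ M′ → g₀ ≡ g₀′ → g₁ ≡ g₁′ → G₀ ≡ G₀′ → G₁ ≡ G₁′ →
    twoByTwo k M g₀ g₁ G₀ G₁ ≡ twoByTwo k M′ g₀′ g₁′ G₀′ G₁′
  twoByTwo-cong k refl refl refl refl refl = refl

  det-cycleMatrix : ∀ k M → detℕ (suc (suc M)) (cycleMatrix k)
    ≡ twoByTwo (+ k) (+ M) (cycDist k M) (cycDist k (suc M)) (cycDistSum k M) (cycDistSum k (suc M))
  det-cycleMatrix k M = trans det-2×2 (cong₂ _-_ (cong₂ _*_ corner₀₀ corner₁₁) (cong₂ _*_ corner₀₁ corner₁₀))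
    where
    open CycleMatrixReduction k M
    T-column₀ : ∀ x → T x 0 ≡ cycDist k x
    T-column₀ x = cong (cycDist k) (ℕP.∣-∣-identityʳ x)
    ∣M-1+M∣≡1 : ∀ M → ∣ M - suc M ∣ ≡ 1
    ∣M-1+M∣≡1 zero    = refl
    ∣M-1+M∣≡1 (suc M) = ∣M-1+M∣≡1 M
    prefix₀ : rowPrefix M M ≡ cycDistSum k M
    prefix₀ = trans (sym (ℤP.+-identityʳ _))
      (subst (λ z → rowPrefix z M + cycDistSum k 0 ≡ cycDistSum k z) (ℕP.+-identityʳ M) (rowPrefix-closed k M M 0))
    prefix₁ : rowPrefix (suc M) M ≡ cycDistSum k (suc M)
    prefix₁ = trans (sym (ℤP.+-identityʳ _))
      (subst (λ z → rowPrefix z M + cycDistSum k 1 ≡ cycDistSum k z) (ℕP.+-comm M 1) (rowPrefix-closed k M M 1))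
    corner₀₀ : swept M M 0 ≡ cycDist k M + ℓ * (cycDistSum k M - + M * cycDist k M)
    corner₀₀ = trans (sweptColumn-lower M M ℕP.≤-refl ℕP.≤-refl)
                     (cong₂ (λ u v → u + ℓ * (v - + M * u)) (T-column₀ M) prefix₀)
    corner₁₁ : swept M (suc M) (suc M) ≡ + 0 - cycDist k (suc M)
    corner₁₁ = trans (W-lower (suc M) M (ℕP.n≤1+n M) ℕP.≤-refl)
                     (cong₂ _-_ (cong (cycDist k) (ℕP.∣n-n∣≡0 M)) (T-column₀ (suc M)))
    corner₀₁ : swept M M (suc M) ≡ + k - cycDist k M
    corner₀₁ = trans (W-lower M M ℕP.≤-refl ℕP.≤-refl) (cong₂ _-_ (cong (cycDist k) (∣M-1+M∣≡1 M)) (T-column₀ M))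
    corner₁₀ : swept M (suc M) 0 ≡ cycDist k (suc M) + ℓ * (cycDistSum k (suc M) - + M * cycDist k (suc M))
    corner₁₀ = trans (sweptColumn-lower M (suc M) (ℕP.n≤1+n M) ℕP.≤-refl)
                     (cong₂ (λ u v → u + ℓ * (v - + M * u)) (T-column₀ (suc M)) prefix₁)

  det-cycleMatrix-full : ∀ a → detℕ (cycleLength (suc a)) (cycleMatrix (suc a)) ≡ + suc a * (+ suc a + + 1)
  det-cycleMatrix-full a = begin
    detℕ (cycleLength (suc a)) (cycleMatrix (suc a))
      ≡⟨ cong (λ n → detℕ n (cycleMatrix (suc a))) size ⟨
    detℕ (suc (suc M)) (cycleMatrix (suc a))
      ≡⟨ det-cycleMatrix (suc a) M ⟩
    twoByTwo (+ suc a) (+ M) (cycDist (suc a) M) (cycDist (suc a) (suc M)) (cycDistSum (suc a) M) (cycDistSum (suc a) (suc M))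
      ≡⟨ twoByTwo-cong (+ suc a) (cong (λ n → + suc n) (double≡+ a)) (cycDist-odd (suc a) a) (cycDist-even (suc a) (suc a))
                       (cycDistSum-odd (suc a) a) (cycDistSum-even (suc a) (suc a)) ⟩
    twoByTwo (+ 1 + + a) (+ 1 + (+ a + + a)) (+ 1 + + a - + a) (+ 1 + + a) (+ a * (+ 1 + + a) + + a) ((+ 1 + + a) * (+ 1 + + a))
      ≡⟨ evaluate (+ a) ⟩
    + suc a * (+ suc a + + 1) ∎
    where
    M : ℕ
    M = suc (double a)
    size : suc (suc M) ≡ cycleLength (suc a)
    size = cong (suc ∘ suc) (trans (cong suc (double≡+ a)) (sym (ℕP.+-suc a a)))
    evaluate : ∀ x → let k = + 1 + x in
      ((k - x) + (+ 1 + (k + k)) * ((x * k + x) - (+ 1 + (x + x)) * (k - x))) * (+ 0 - k)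
        - (k - (k - x)) * (k + (+ 1 + (k + k)) * (k * k - (+ 1 + (x + x)) * k))
      ≡ k * (k + + 1)
    evaluate = solve-∀

  det-cycleMatrix-vertexDeleted : ∀ a → detℕ (suc a ℕ.+ suc a) (cycleMatrix (suc a)) ≡ + 1 - + 2 * (+ suc a * + suc a)
  det-cycleMatrix-vertexDeleted a = begin
    detℕ (suc a ℕ.+ suc a) (cycleMatrix (suc a))
      ≡⟨ cong (λ n → detℕ n (cycleMatrix (suc a))) size ⟨
    detℕ (suc (suc M)) (cycleMatrix (suc a))
      ≡⟨ det-cycleMatrix (suc a) M ⟩
    twoByTwo (+ suc a) (+ M) (cycDist (suc a) M) (cycDist (suc a) (suc M)) (cycDistSum (suc a) M) (cycDistSum (suc a) (suc M))
      ≡⟨ twoByTwo-cong (+ suc a) (cong +_ (double≡+ a)) (cycDist-even (suc a) a) (cycDist-odd (suc a) a)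
                       (cycDistSum-even (suc a) a) (cycDistSum-odd (suc a) a) ⟩
    twoByTwo (+ 1 + + a) (+ a + + a) (+ a) (+ 1 + + a - + a) (+ a * (+ 1 + + a)) (+ a * (+ 1 + + a) + + a)
      ≡⟨ evaluate (+ a) ⟩
    + 1 - + 2 * (+ suc a * + suc a) ∎
    where
    M : ℕ
    M = double a
    size : suc (suc M) ≡ suc a ℕ.+ suc a
    size = cong suc (trans (cong suc (double≡+ a)) (sym (ℕP.+-suc a a)))
    evaluate : ∀ x → let k = + 1 + x in
      (x + (+ 1 + (k + k)) * (x * k - (x + x) * x)) * (+ 0 - (k - x))
        - (k - x) * ((k - x) + (+ 1 + (k + k)) * ((x * k + x) - (x + x) * (k - x)))
      ≡ + 1 - + 2 * (k * k)
    evaluate = solve-∀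

module TwinElimination where

  open import Defs
  open Determinant
  open IndexedDeterminant
  open CycleMatrixDeterminant
  open import Data.Nat as ℕ using (ℕ; zero; suc; _<_; _≤_; ∣_-_∣; _⊓_)
  import Data.Nat.Properties as ℕP
  open import Data.Integer using (ℤ; +_; -_; _+_; _*_; _-_; _^_)
  import Data.Integer.Properties as ℤP
  open import Data.Integer.Tactic.RingSolver using (solve-∀)
  open import Function using (_∘_)
  open import Relation.Nullary using (Dec; yes; no)
  open import Relation.Nullary.Negation using (contradiction)
  open import Relation.Binary.Definitions using (tri<; tri≈; tri>)
  open import Relation.Binary.PropositionalEquality
  open ≡-Reasoning

  twinDist : ℕ → ℕ → ℤ
  twinDist s t with s ℕ.≟ t
  ... | yes _ = + 0
  ... | no  _ = + 2

  twinDist-refl : ∀ s → twinDist s s ≡ + 0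
  twinDist-refl s with s ℕ.≟ s
  ... | yes _   = refl
  ... | no  s≢s = contradiction refl s≢s

  twinDist-≢ : ∀ {s t} → s ≢ t → twinDist s t ≡ + 2
  twinDist-≢ {s} {t} s≢t with s ℕ.≟ t
  ... | yes s≡t = contradiction s≡t s≢t
  ... | no  _   = refl

  -- Indices 0..c carry the cycle matrix; every index beyond c is a twin of c (same distances, mutual distance 2).
  withTwins : ℕ → ℕ → ℕ → ℕ → ℤ
  withTwins k c s t with c ℕ.≤? s | c ℕ.≤? t
  ... | yes _ | yes _ = twinDist s t
  ... | _     | _     = cycleMatrix k (s ⊓ c) (t ⊓ c)

  module _ (k c : ℕ) where

    withTwins-twins : ∀ s t → c ≤ s → c ≤ t → withTwins k c s t ≡ twinDist s t
    withTwins-twins s t c≤s c≤t with c ℕ.≤? s | c ℕ.≤? t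
    ... | yes _   | yes _   = refl
    ... | no  c≰s | _       = contradiction c≤s c≰s
    ... | yes _   | no  c≰t = contradiction c≤t c≰t

    withTwins-rowCycle : ∀ s t → s < c → withTwins k c s t ≡ cycleMatrix k (s ⊓ c) (t ⊓ c)
    withTwins-rowCycle s t s<c with c ℕ.≤? s | c ℕ.≤? t
    ... | yes c≤s | _ = contradiction c≤s (ℕP.<⇒≱ s<c)
    ... | no  _   | _ = refl

    withTwins-columnCycle : ∀ s t → t < c → withTwins k c s t ≡ cycleMatrix k (s ⊓ c) (t ⊓ c)
    withTwins-columnCycle s t t<c with c ℕ.≤? s | c ℕ.≤? t
    ... | yes _ | yes c≤t = contradiction c≤t (ℕP.<⇒≱ t<c)
    ... | yes _ | no  _   = refl
    ... | no  _ | _       = refl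

    twinColumn : ℤ → ℤ → ℕ → ℤ
    twinColumn α β s with s ℕ.<? c | s ℕ.≟ c
    ... | yes _ | _     = α * cycleMatrix k s c
    ... | no  _ | yes _ = β
    ... | no  _ | no  _ = β + + 2

    twinColumn-< : ∀ α β s → s < c → twinColumn α β s ≡ α * cycleMatrix k s c
    twinColumn-< α β s s<c with s ℕ.<? c | s ℕ.≟ c
    ... | yes _   | _ = refl
    ... | no  s≮c | _ = contradiction s<c s≮c

    twinColumn-≡ : ∀ α β → twinColumn α β c ≡ β
    twinColumn-≡ α β with c ℕ.<? c | c ℕ.≟ c
    ... | yes c<c | _       = contradiction c<c (ℕP.<-irrefl refl)
    ... | no  _   | yes _   = refl
    ... | no  _   | no  c≢c = contradiction refl c≢c

    twinColumn-> : ∀ α β s → c < s → twinColumn α β s ≡ β + + 2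
    twinColumn-> α β s c<s with s ℕ.<? c | s ℕ.≟ c
    ... | yes s<c | _       = contradiction s<c (ℕP.<-asym c<s)
    ... | no  _   | yes s≡c = contradiction (sym s≡c) (ℕP.<⇒≢ c<s)
    ... | no  _   | no  _   = refl

    withTwinColumn : ℤ → ℤ → ℕ → ℕ → ℤ
    withTwinColumn α β = updateColumn c (twinColumn α β) (withTwins k c)

    withTwins-twin : ∀ s y → c < s → y ≢ c → y ≢ s → withTwins k c s y ≡ withTwins k c c y
    withTwins-twin s y c<s y≢c y≢s with ℕP.<-cmp y c
    ... | tri< y<c _ _ = trans (withTwins-columnCycle s y y<c)
                         (trans (cong (λ z → cycleMatrix k z (y ⊓ c)) (trans s⊓c≡c (sym (ℕP.⊓-idem c))))
                                (sym (withTwins-columnCycle c y y<c)))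
      where
      s⊓c≡c : s ⊓ c ≡ c
      s⊓c≡c = ℕP.m≥n⇒m⊓n≡n (ℕP.<⇒≤ c<s)
    ... | tri≈ _ y≡c _ = contradiction y≡c y≢c
    ... | tri> _ _ c<y = trans (withTwins-twins s y (ℕP.<⇒≤ c<s) (ℕP.<⇒≤ c<y))
                         (trans (twinDist-≢ (y≢s ∘ sym))
                                (sym (trans (withTwins-twins c y ℕP.≤-refl (ℕP.<⇒≤ c<y)) (twinDist-≢ (ℕP.<⇒≢ c<y)))))

    twinColumn-absorb : ∀ α β s x → c < s → x ≢ s →
      twinColumn α β x + + 1 * withTwins k c x s ≡ twinColumn (α + + 1) (β + + 2) x
    twinColumn-absorb α β s x c<s x≢s with ℕP.<-cmp x c
    ... | tri< x<c _ _ = begin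
      twinColumn α β x + + 1 * withTwins k c x s
        ≡⟨ cong₂ (λ u v → u + + 1 * v) (twinColumn-< α β x x<c)
                 (trans (withTwins-rowCycle x s x<c)
                        (cong₂ (cycleMatrix k) (ℕP.m≤n⇒m⊓n≡m (ℕP.<⇒≤ x<c)) (ℕP.m≥n⇒m⊓n≡n (ℕP.<⇒≤ c<s)))) ⟩
      α * cycleMatrix k x c + + 1 * cycleMatrix k x c
        ≡⟨ collect α (cycleMatrix k x c) ⟩
      (α + + 1) * cycleMatrix k x c
        ≡⟨ twinColumn-< (α + + 1) (β + + 2) x x<c ⟨
      twinColumn (α + + 1) (β + + 2) x ∎
      where
      collect : ∀ a b → a * b + + 1 * b ≡ (a + + 1) * b
      collect = solve-∀
    ... | tri≈ _ refl _ = trans (cong₂ (λ u v → u + + 1 * v) (twinColumn-≡ α β)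
                                       (trans (withTwins-twins c s ℕP.≤-refl (ℕP.<⇒≤ c<s)) (twinDist-≢ x≢s)))
                                (sym (twinColumn-≡ (α + + 1) (β + + 2)))
    ... | tri> _ _ c<x = trans (cong₂ (λ u v → u + + 1 * v) (twinColumn-> α β x c<x)
                                      (trans (withTwins-twins x s (ℕP.<⇒≤ c<x) (ℕP.<⇒≤ c<s)) (twinDist-≢ x≢s)))
                               (sym (twinColumn-> (α + + 1) (β + + 2) x c<x))

    -- Subtracting row c from the last row and adding the last column to column c isolates the entry −2.
    det-eliminateTwin : ∀ j α β → detℕ (suc (j ℕ.+ suc c)) (withTwinColumn α β)
                                ≡ - + 2 * detℕ (j ℕ.+ suc c) (withTwinColumn (α + + 1) (β + + 2))
    det-eliminateTwin j α β = begin
      detℕ n Q₀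
        ≡⟨ detℕ-addRow n Q₀ ℓ c (- + 1) ℓ<n c<n (ℕP.<⇒≢ c<ℓ ∘ sym) ⟨
      detℕ n Q₁
        ≡⟨ detℕ-addColumn n Q₁ c ℓ (+ 1) c<n ℓ<n (ℕP.<⇒≢ c<ℓ) ⟨
      detℕ n Q₂
        ≡⟨ detℕ-singleEntryRow ℓ Q₂ ℓ ℓ ℓ<n ℓ<n lastRow ⟩
      sign ℓ * (sign ℓ * (Q₂ ℓ ℓ * detℕ ℓ (λ x y → Q₂ (punchInℕ ℓ x) (punchInℕ ℓ y))))
        ≡⟨ cong₂ (λ u v → sign ℓ * (sign ℓ * (u * v))) corner (detℕ-cong ℓ leading) ⟩
      sign ℓ * (sign ℓ * (- + 2 * detℕ ℓ (withTwinColumn (α + + 1) (β + + 2))))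
        ≡⟨ sign-move ℓ refl ⟨
      - + 2 * detℕ ℓ (withTwinColumn (α + + 1) (β + + 2)) ∎
      where
      ℓ n : ℕ
      ℓ = j ℕ.+ suc c
      n = suc ℓ
      c<ℓ : c < ℓ
      c<ℓ = ℕP.m≤n+m (suc c) j
      c<n : c < n
      c<n = ℕP.<-trans c<ℓ (ℕP.n<1+n ℓ)
      ℓ<n : ℓ < n
      ℓ<n = ℕP.n<1+n ℓ
      Q₀ Q₁ Q₂ : ℕ → ℕ → ℤ
      Q₀ = withTwinColumn α β
      Q₁ = updateRow ℓ (λ t → Q₀ ℓ t + - + 1 * Q₀ c t) Q₀
      Q₂ = updateColumn c (λ s → Q₁ s c + + 1 * Q₁ s ℓ) Q₁
      Q₀-off : ∀ s t → t ≢ c → Q₀ s t ≡ withTwins k c s t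
      Q₀-off s t = updateColumn-≢ c _ (withTwins k c) s
      Q₀-on : ∀ s → Q₀ s c ≡ twinColumn α β s
      Q₀-on = updateColumn-≡ c _ (withTwins k c)
      Q₁ℓ : ∀ t → Q₁ ℓ t ≡ Q₀ ℓ t + - + 1 * Q₀ c t
      Q₁ℓ = updateRow-≡ ℓ _ Q₀
      ℓ≢c : ℓ ≢ c
      ℓ≢c = ℕP.<⇒≢ c<ℓ ∘ sym
      Q₁ℓℓ : Q₁ ℓ ℓ ≡ - + 2
      Q₁ℓℓ = trans (Q₁ℓ ℓ) (cong₂ (λ u v → u + - + 1 * v)
               (trans (Q₀-off ℓ ℓ ℓ≢c) (trans (withTwins-twins ℓ ℓ (ℕP.<⇒≤ c<ℓ) (ℕP.<⇒≤ c<ℓ)) (twinDist-refl ℓ)))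
               (trans (Q₀-off c ℓ ℓ≢c) (trans (withTwins-twins c ℓ ℕP.≤-refl (ℕP.<⇒≤ c<ℓ)) (twinDist-≢ (ℓ≢c ∘ sym)))))
      corner : Q₂ ℓ ℓ ≡ - + 2
      corner = trans (updateColumn-≢ c _ Q₁ ℓ ℓ≢c) Q₁ℓℓ
      lastRow-c : Q₂ ℓ c ≡ + 0
      lastRow-c = begin
        Q₂ ℓ c                                                  ≡⟨ updateColumn-≡ c _ Q₁ ℓ ⟩
        Q₁ ℓ c + + 1 * Q₁ ℓ ℓ                                    ≡⟨ cong₂ (λ u v → u + + 1 * v) (Q₁ℓ c) Q₁ℓℓ ⟩
        Q₀ ℓ c + - + 1 * Q₀ c c + + 1 * - + 2                    ≡⟨ cong₂ (λ u v → u + - + 1 * v + + 1 * - + 2)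
                                                                          (trans (Q₀-on ℓ) (twinColumn-> α β ℓ c<ℓ))
                                                                          (trans (Q₀-on c) (twinColumn-≡ α β)) ⟩
        β + + 2 + - + 1 * β + + 1 * - + 2                        ≡⟨ cancel β ⟩
        + 0                                                     ∎
        where
        cancel : ∀ b → b + + 2 + - + 1 * b + + 1 * - + 2 ≡ + 0
        cancel = solve-∀
      lastRow : ∀ y → y < n → y ≢ ℓ → Q₂ ℓ y ≡ + 0
      lastRow y _ y≢ℓ = by-cases (y ℕ.≟ c)
        where
        cancel : ∀ a → a + - + 1 * a ≡ + 0
        cancel = solve-∀
        by-cases : Dec (y ≡ c) → Q₂ ℓ y ≡ + 0
        by-cases (yes y≡c) = subst (λ z → Q₂ ℓ z ≡ + 0) (sym y≡c) lastRow-c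
        by-cases (no  y≢c) = begin
          Q₂ ℓ y                          ≡⟨ updateColumn-≢ c _ Q₁ ℓ y≢c ⟩
          Q₁ ℓ y                          ≡⟨ Q₁ℓ y ⟩
          Q₀ ℓ y + - + 1 * Q₀ c y         ≡⟨ cong (λ u → u + - + 1 * Q₀ c y)
                                              (trans (Q₀-off ℓ y y≢c) (trans (withTwins-twin ℓ y c<ℓ y≢c y≢ℓ) (sym (Q₀-off c y y≢c)))) ⟩
          Q₀ c y + - + 1 * Q₀ c y         ≡⟨ cancel (Q₀ c y) ⟩
          + 0                             ∎
      leading-c : ∀ x → x < ℓ → Q₂ x c ≡ withTwinColumn (α + + 1) (β + + 2) x c
      leading-c x x<ℓ = begin
        Q₂ x c                                     ≡⟨ updateColumn-≡ c _ Q₁ x ⟩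
        Q₁ x c + + 1 * Q₁ x ℓ                      ≡⟨ cong₂ (λ u v → u + + 1 * v) (updateRow-≢ ℓ _ Q₀ c x≢ℓ) (updateRow-≢ ℓ _ Q₀ ℓ x≢ℓ) ⟩
        Q₀ x c + + 1 * Q₀ x ℓ                      ≡⟨ cong₂ (λ u v → u + + 1 * v) (Q₀-on x) (Q₀-off x ℓ ℓ≢c) ⟩
        twinColumn α β x + + 1 * withTwins k c x ℓ ≡⟨ twinColumn-absorb α β ℓ x c<ℓ x≢ℓ ⟩
        twinColumn (α + + 1) (β + + 2) x           ≡⟨ updateColumn-≡ c _ (withTwins k c) x ⟨
        withTwinColumn (α + + 1) (β + + 2) x c     ∎
        where
        x≢ℓ : x ≢ ℓ
        x≢ℓ = ℕP.<⇒≢ x<ℓ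
      leading : ∀ x y → x < ℓ → y < ℓ → Q₂ (punchInℕ ℓ x) (punchInℕ ℓ y) ≡ withTwinColumn (α + + 1) (β + + 2) x y
      leading x y x<ℓ y<ℓ = trans (cong₂ Q₂ (punchInℕ-below ℓ x x<ℓ) (punchInℕ-below ℓ y y<ℓ)) (by-cases (y ℕ.≟ c))
        where
        by-cases : Dec (y ≡ c) → Q₂ x y ≡ withTwinColumn (α + + 1) (β + + 2) x y
        by-cases (yes y≡c) = subst (λ z → Q₂ x z ≡ withTwinColumn (α + + 1) (β + + 2) x z) (sym y≡c) (leading-c x x<ℓ)
        by-cases (no  y≢c) = trans (updateColumn-≢ c _ Q₁ x y≢c)
                             (trans (updateRow-≢ ℓ _ Q₀ y (ℕP.<⇒≢ x<ℓ))
                             (trans (Q₀-off x y y≢c) (sym (updateColumn-≢ c _ (withTwins k c) x y≢c))))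

    det-eliminateTwins : ∀ j α β → detℕ (j ℕ.+ suc c) (withTwinColumn α β)
                                ≡ (- + 2) ^ j * detℕ (suc c) (withTwinColumn (α + + j) (β + + 2 * + j))
    det-eliminateTwins zero    α β =
      trans (cong₂ (λ a b → detℕ (suc c) (withTwinColumn a b)) (sym (ℤP.+-identityʳ α)) (sym (ℤP.+-identityʳ β)))
            (sym (ℤP.*-identityˡ _))
    det-eliminateTwins (suc j) α β = begin
      detℕ (suc (j ℕ.+ suc c)) (withTwinColumn α β)
        ≡⟨ det-eliminateTwin j α β ⟩
      - + 2 * detℕ (j ℕ.+ suc c) (withTwinColumn (α + + 1) (β + + 2))
        ≡⟨ cong (- + 2 *_) (det-eliminateTwins j (α + + 1) (β + + 2)) ⟩
      - + 2 * ((- + 2) ^ j * detℕ (suc c) (withTwinColumn (α + + 1 + + j) (β + + 2 + + 2 * + j)))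
        ≡⟨ cong₂ (λ a b → - + 2 * ((- + 2) ^ j * detℕ (suc c) (withTwinColumn a b))) (shiftα α (+ j)) (shiftβ β (+ j)) ⟩
      - + 2 * ((- + 2) ^ j * detℕ (suc c) (withTwinColumn (α + + suc j) (β + + 2 * + suc j)))
        ≡⟨ ℤP.*-assoc (- + 2) ((- + 2) ^ j) _ ⟨
      (- + 2) ^ suc j * detℕ (suc c) (withTwinColumn (α + + suc j) (β + + 2 * + suc j)) ∎
      where
      shiftα : ∀ a j → a + + 1 + j ≡ a + (+ 1 + j)
      shiftα = solve-∀
      shiftβ : ∀ b j → b + + 2 + + 2 * j ≡ b + + 2 * (+ 1 + j)
      shiftβ = solve-∀

    det-withTwinColumn-noTwins : ∀ α β → detℕ (suc c) (withTwinColumn α β)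
                                      ≡ α * detℕ (suc c) (cycleMatrix k) + β * detℕ c (cycleMatrix k)
    det-withTwinColumn-noTwins α β = begin
      detℕ (suc c) (withTwinColumn α β)
        ≡⟨ detℕ-columnLinear (suc c) scaled unit (withTwinColumn α β) c β c<1+c off-c (λ x y _ _ y≢c → unit≗scaled x y y≢c) on-c ⟩
      detℕ (suc c) scaled + β * detℕ (suc c) unit
        ≡⟨ cong₂ (λ u v → u + β * v) (detℕ-scaleColumn (suc c) T c α c<1+c) (detℕ-unitLastColumn c T) ⟩
      α * detℕ (suc c) T + β * detℕ c T ∎
      where
      T : ℕ → ℕ → ℤ
      T = cycleMatrix k
      c<1+c : c < suc c
      c<1+c = ℕP.n<1+n c
      scaled unit : ℕ → ℕ → ℤ
      scaled = updateColumn c (λ x → α * T x c) T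
      unit = updateColumn c (λ x → δ x c) T
      unit≗scaled : ∀ x y → y ≢ c → unit x y ≡ scaled x y
      unit≗scaled x y y≢c = trans (updateColumn-≢ c _ T x y≢c) (sym (updateColumn-≢ c _ T x y≢c))
      off-c : ∀ x y → x < suc c → y < suc c → y ≢ c → withTwinColumn α β x y ≡ scaled x y
      off-c x y x<1+c y<1+c y≢c = begin
        withTwinColumn α β x y            ≡⟨ updateColumn-≢ c _ (withTwins k c) x y≢c ⟩
        withTwins k c x y                 ≡⟨ withTwins-columnCycle x y y<c ⟩
        cycleMatrix k (x ⊓ c) (y ⊓ c)     ≡⟨ cong₂ (cycleMatrix k) (ℕP.m≤n⇒m⊓n≡m (ℕP.≤-pred x<1+c)) (ℕP.m≤n⇒m⊓n≡m (ℕP.<⇒≤ y<c)) ⟩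
        T x y                             ≡⟨ updateColumn-≢ c _ T x y≢c ⟨
        scaled x y                        ∎
        where
        y<c : y < c
        y<c = ℕP.≤∧≢⇒< (ℕP.≤-pred y<1+c) y≢c
      on-c : ∀ x → x < suc c → withTwinColumn α β x c ≡ scaled x c + β * unit x c
      on-c x x<1+c = trans (updateColumn-≡ c _ (withTwins k c) x)
        (trans column (sym (cong₂ (λ u v → u + β * v) (updateColumn-≡ c _ T x) (updateColumn-≡ c _ T x))))
        where
        no-unit : ∀ a b → a ≡ a + b * + 0
        no-unit = solve-∀
        unit-only : ∀ a b → b ≡ a * + 0 + b * + 1
        unit-only = solve-∀
        column : twinColumn α β x ≡ α * T x c + β * δ x c
        column with ℕP.<-cmp x c
        ... | tri< x<c _ _ = trans (twinColumn-< α β x x<c)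
                             (trans (no-unit (α * T x c) β) (cong (λ d → α * T x c + β * d) (sym (δ-≢ (ℕP.<⇒≢ x<c)))))
        ... | tri≈ _ refl _ = trans (twinColumn-≡ α β)
                             (trans (unit-only α β) (sym (cong₂ (λ t d → α * t + β * d) (cong (cycDist k) (ℕP.∣n-n∣≡0 x)) (δ-refl x))))
        ... | tri> _ _ c<x = contradiction (ℕP.≤-pred x<1+c) (ℕP.<⇒≱ c<x)

    withTwinColumn-initial : ∀ s t → withTwinColumn (+ 1) (+ 0) s t ≡ withTwins k c s t
    withTwinColumn-initial s t = by-cases (t ℕ.≟ c)
      where
      column : twinColumn (+ 1) (+ 0) s ≡ withTwins k c s c
      column with ℕP.<-cmp s c
      ... | tri< s<c _ _ = trans (twinColumn-< (+ 1) (+ 0) s s<c)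
                           (trans (ℤP.*-identityˡ _)
                           (sym (trans (withTwins-rowCycle s c s<c) (cong₂ (cycleMatrix k) (ℕP.m≤n⇒m⊓n≡m (ℕP.<⇒≤ s<c)) (ℕP.⊓-idem c)))))
      ... | tri≈ _ refl _ = trans (twinColumn-≡ (+ 1) (+ 0)) (sym (trans (withTwins-twins s s ℕP.≤-refl ℕP.≤-refl) (twinDist-refl s)))
      ... | tri> _ _ c<s = trans (twinColumn-> (+ 1) (+ 0) s c<s)
                           (sym (trans (withTwins-twins s c (ℕP.<⇒≤ c<s) ℕP.≤-refl) (twinDist-≢ (ℕP.<⇒≢ c<s ∘ sym))))
      by-cases : Dec (t ≡ c) → withTwinColumn (+ 1) (+ 0) s t ≡ withTwins k c s t
      by-cases (no  t≢c) = updateColumn-≢ c _ (withTwins k c) s t≢c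
      by-cases (yes t≡c) = subst (λ z → withTwinColumn (+ 1) (+ 0) s z ≡ withTwins k c s z) (sym t≡c)
                                 (trans (updateColumn-≡ c _ (withTwins k c) s) column)

    det-withTwins : ∀ R → detℕ (R ℕ.+ suc c) (withTwins k c)
      ≡ (- + 2) ^ R * ((+ 1 + + R) * detℕ (suc c) (cycleMatrix k) + (+ 0 + + 2 * + R) * detℕ c (cycleMatrix k))
    det-withTwins R = begin
      detℕ (R ℕ.+ suc c) (withTwins k c)
        ≡⟨ detℕ-cong (R ℕ.+ suc c) (λ s t _ _ → withTwinColumn-initial s t) ⟨
      detℕ (R ℕ.+ suc c) (withTwinColumn (+ 1) (+ 0))
        ≡⟨ det-eliminateTwins R (+ 1) (+ 0) ⟩
      (- + 2) ^ R * detℕ (suc c) (withTwinColumn (+ 1 + + R) (+ 0 + + 2 * + R))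
        ≡⟨ cong ((- + 2) ^ R *_) (det-withTwinColumn-noTwins (+ 1 + + R) (+ 0 + + 2 * + R)) ⟩
      (- + 2) ^ R * ((+ 1 + + R) * detℕ (suc c) (cycleMatrix k) + (+ 0 + + 2 * + R) * detℕ c (cycleMatrix k)) ∎

module OddCycleMetric where

  open import Data.Nat as ℕ using (ℕ; zero; suc; _<_; _≤_; z≤n; s≤s; ∣_-_∣; _⊓_; _∸_; _+_)
  import Data.Nat.Properties as ℕP
  open import Data.Product using (Σ-syntax; _×_; _,_)
  open import Data.Sum as Sum using (_⊎_; inj₁; inj₂)
  open import Function using (_∘_)
  open import Relation.Nullary using (¬_; yes; no)
  open import Relation.Nullary.Negation using (contradiction)
  open import Relation.Binary.Definitions using (tri<; tri≈; tri>)
  open import Relation.Binary.PropositionalEquality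

  ∣suc-∣-< : ∀ a e → a < e → suc ∣ suc a - e ∣ ≡ ∣ a - e ∣
  ∣suc-∣-< zero    (suc e) (s≤s z≤n)   = refl
  ∣suc-∣-< (suc a) (suc e) (s≤s a<e) = ∣suc-∣-< a e a<e

  ∣suc-∣-≥ : ∀ a e → e ≤ a → ∣ suc a - e ∣ ≡ suc ∣ a - e ∣
  ∣suc-∣-≥ zero    zero    _         = refl
  ∣suc-∣-≥ (suc a) zero    _         = refl
  ∣suc-∣-≥ (suc a) (suc e) (s≤s e≤a) = ∣suc-∣-≥ a e e≤a

  ∣-∣≡1 : ∀ {a b} → ∣ a - b ∣ ≡ 1 → (b ≡ suc a) ⊎ (a ≡ suc b)
  ∣-∣≡1 {zero}        {suc zero}    _ = inj₁ refl
  ∣-∣≡1 {suc zero}    {zero}        _ = inj₂ refl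
  ∣-∣≡1 {suc a}       {suc b}       e = Sum.map (cong suc) (cong suc) (∣-∣≡1 e)
  ∣-∣≡1 {zero}        {zero}        ()
  ∣-∣≡1 {zero}        {suc (suc b)} ()
  ∣-∣≡1 {suc (suc a)} {zero}        ()

  ∣n-1+n∣≡1 : ∀ a → ∣ a - suc a ∣ ≡ 1
  ∣n-1+n∣≡1 zero    = refl
  ∣n-1+n∣≡1 (suc a) = ∣n-1+n∣≡1 a

  module OddCycle (k : ℕ) where

    c : ℕ
    c = k + k

    L : ℕ
    L = suc c

    offsetDist : ℕ → ℕ
    offsetDist d = d ⊓ (L ∸ d)

    offsetDist-≤k : ∀ d → d ≤ k → offsetDist d ≡ d
    offsetDist-≤k d d≤k = ℕP.m≤n⇒m⊓n≡m (ℕP.m+n≤o⇒m≤o∸n d (ℕP.≤-trans (ℕP.+-mono-≤ d≤k d≤k) (ℕP.n≤1+n c)))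

    offsetDist->k : ∀ d → k < d → offsetDist d ≡ L ∸ d
    offsetDist->k d k<d = ℕP.m≥n⇒m⊓n≡n (ℕP.m≤n+o⇒m∸n≤o L d (ℕP.+-mono-≤ k<d (ℕP.<⇒≤ k<d)))

    offsetDist-reflect : ∀ d → d ≤ L → offsetDist (L ∸ d) ≡ offsetDist d
    offsetDist-reflect d d≤L = trans (cong ((L ∸ d) ⊓_) (ℕP.m∸[m∸n]≡n d≤L)) (ℕP.⊓-comm (L ∸ d) d)

    offsetDist-up : ∀ d → d < k → offsetDist (suc d) ≡ suc (offsetDist d)
    offsetDist-up d d<k = trans (offsetDist-≤k (suc d) d<k) (cong suc (sym (offsetDist-≤k d (ℕP.<⇒≤ d<k))))

    offsetDist-middle : offsetDist (suc k) ≡ offsetDist k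
    offsetDist-middle = trans (offsetDist->k (suc k) ℕP.≤-refl) (trans (ℕP.m+n∸m≡n k k) (sym (offsetDist-≤k k ℕP.≤-refl)))

    offsetDist-down : ∀ d → k < d → d < L → offsetDist d ≡ suc (offsetDist (suc d))
    offsetDist-down d k<d d<L = trans (offsetDist->k d k<d)
      (trans (ℕP.+-∸-assoc 1 d<L) (cong suc (sym (offsetDist->k (suc d) (ℕP.m≤n⇒m≤1+n k<d)))))

    offsetDist-≤ : ∀ d → offsetDist d ≤ k
    offsetDist-≤ d with d ℕ.≤? k
    ... | yes d≤k = subst (_≤ k) (sym (offsetDist-≤k d d≤k)) d≤k
    ... | no  d≰k = subst (_≤ k) (sym (offsetDist->k d (ℕP.≰⇒> d≰k)))
                          (ℕP.m≤n+o⇒m∸n≤o L d (ℕP.+-mono-≤ (ℕP.≰⇒> d≰k) ℕP.≤-refl))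

    offsetDist-positive : ∀ d → 0 < d → d < L → 0 < offsetDist d
    offsetDist-positive d 0<d d<L with d ℕ.≤? k
    ... | yes d≤k = subst (0 <_) (sym (offsetDist-≤k d d≤k)) 0<d
    ... | no  d≰k = subst (0 <_) (sym (offsetDist->k d (ℕP.≰⇒> d≰k))) (ℕP.m<n⇒0<n∸m d<L)

    offsetDist-sucˡ : ∀ d → offsetDist (suc d) ≤ suc (offsetDist d)
    offsetDist-sucˡ d with ℕP.<-cmp d k
    ... | tri< d<k _ _ = ℕP.≤-reflexive (offsetDist-up d d<k)
    ... | tri≈ _ refl _ = ℕP.≤-trans (ℕP.≤-reflexive offsetDist-middle) (ℕP.n≤1+n _)
    ... | tri> _ _ k<d with suc d ℕ.≤? L
    ...   | yes d<L = ℕP.≤-trans (ℕP.≤-trans (ℕP.n≤1+n _) (ℕP.≤-reflexive (sym (offsetDist-down d k<d d<L)))) (ℕP.n≤1+n _)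
    ...   | no  d≮L = subst (_≤ suc (offsetDist d))
                            (sym (trans (offsetDist->k (suc d) (ℕP.m≤n⇒m≤1+n k<d))
                                        (ℕP.m≤n⇒m∸n≡0 (ℕP.≤-trans (ℕP.n≤1+n L) (ℕP.≰⇒> d≮L)))))
                            z≤n

    offsetDist-sucʳ : ∀ d → offsetDist d ≤ suc (offsetDist (suc d))
    offsetDist-sucʳ d with ℕP.<-cmp d k
    ... | tri< d<k _ _ = ℕP.≤-trans (ℕP.≤-trans (ℕP.n≤1+n _) (ℕP.≤-reflexive (sym (offsetDist-up d d<k)))) (ℕP.n≤1+n _)
    ... | tri≈ _ refl _ = ℕP.≤-trans (ℕP.≤-reflexive (sym offsetDist-middle)) (ℕP.n≤1+n _)
    ... | tri> _ _ k<d with suc d ℕ.≤? L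
    ...   | yes d<L = ℕP.≤-reflexive (offsetDist-down d k<d d<L)
    ...   | no  d≮L = subst (_≤ suc (offsetDist (suc d)))
                            (sym (trans (offsetDist->k d k<d) (ℕP.m≤n⇒m∸n≡0 (ℕP.≤-pred (ℕP.≰⇒> d≮L)))))
                            z≤n

    cycleMetric : ℕ → ℕ → ℕ
    cycleMetric a b = offsetDist ∣ a - b ∣

    CycleAdjacent : ℕ → ℕ → Set
    CycleAdjacent a b = (∣ a - b ∣ ≡ 1) ⊎ ((a ≡ 0 × b ≡ c) ⊎ (a ≡ c × b ≡ 0))

    CycleAdjacent-sym : ∀ {a b} → CycleAdjacent a b → CycleAdjacent b a
    CycleAdjacent-sym {a} {b} (inj₁ e)               = inj₁ (trans (ℕP.∣-∣-comm b a) e)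
    CycleAdjacent-sym         (inj₂ (inj₁ (a≡0 , b≡c))) = inj₂ (inj₂ (b≡c , a≡0))
    CycleAdjacent-sym         (inj₂ (inj₂ (a≡c , b≡0))) = inj₂ (inj₁ (b≡0 , a≡c))

    cycleMetric-c : ∀ e → e ≤ c → cycleMetric c e ≡ offsetDist (suc e)
    cycleMetric-c e e≤c = trans (cong offsetDist (ℕP.m≤n⇒∣n-m∣≡n∸m e≤c)) (offsetDist-reflect (suc e) (s≤s e≤c))

    ∣-∣≤c : ∀ a e → a ≤ c → e ≤ c → ∣ a - e ∣ ≤ c
    ∣-∣≤c a e a≤c e≤c = ℕP.≤-trans (ℕP.∣m-n∣≤m⊔n a e) (ℕP.⊔-lub a≤c e≤c)

    cycleMetric-adjacent : ∀ a b e → CycleAdjacent a b → e ≤ c → cycleMetric a e ≤ suc (cycleMetric b e)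
    cycleMetric-adjacent a b e (inj₁ ∣a-b∣≡1) e≤c with ∣-∣≡1 {a} {b} ∣a-b∣≡1
    ... | inj₁ refl with a ℕ.<? e
    ...   | yes a<e = subst (λ z → offsetDist z ≤ suc (cycleMetric (suc a) e)) (∣suc-∣-< a e a<e) (offsetDist-sucˡ _)
    ...   | no  a≮e = subst (λ z → cycleMetric a e ≤ suc (offsetDist z)) (sym (∣suc-∣-≥ a e (ℕP.≮⇒≥ a≮e))) (offsetDist-sucʳ _)
    cycleMetric-adjacent a b e (inj₁ ∣a-b∣≡1) e≤c | inj₂ refl with b ℕ.<? e
    ...   | yes b<e = subst (λ z → cycleMetric (suc b) e ≤ suc (offsetDist z)) (∣suc-∣-< b e b<e) (offsetDist-sucʳ _)
    ...   | no  b≮e = subst (λ z → offsetDist z ≤ suc (cycleMetric b e)) (sym (∣suc-∣-≥ b e (ℕP.≮⇒≥ b≮e))) (offsetDist-sucˡ _)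
    cycleMetric-adjacent a b e (inj₂ (inj₁ (refl , refl))) e≤c =
      subst (λ z → offsetDist e ≤ suc z) (sym (cycleMetric-c e e≤c)) (offsetDist-sucʳ e)
    cycleMetric-adjacent a b e (inj₂ (inj₂ (refl , refl))) e≤c =
      subst (λ z → z ≤ suc (offsetDist e)) (sym (cycleMetric-c e e≤c)) (offsetDist-sucˡ e)

    cycleMetric-descent : ∀ a e → a ≤ c → e ≤ c → a ≢ e →
      Σ[ b ∈ ℕ ] b ≤ c × CycleAdjacent a b × cycleMetric a e ≡ suc (cycleMetric b e)
    cycleMetric-descent a e a≤c e≤c a≢e with ℕP.<-cmp a e
    ... | tri≈ _ a≡e _ = contradiction a≡e a≢e
    ... | tri< a<e _ _ with ∣ a - e ∣ ℕ.≤? k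
    ...   | yes near = suc a , ℕP.≤-trans a<e e≤c , inj₁ (∣n-1+n∣≡1 a) ,
              trans (cong offsetDist (sym (∣suc-∣-< a e a<e)))
                    (offsetDist-up ∣ suc a - e ∣ (subst (_≤ k) (sym (∣suc-∣-< a e a<e)) near))
    ...   | no  far with a
    ...     | zero   = c , ℕP.≤-refl , inj₂ (inj₁ (refl , refl)) ,
                trans (offsetDist-down e (ℕP.≰⇒> far) (s≤s e≤c)) (cong suc (sym (cycleMetric-c e e≤c)))
    ...     | suc a′ = a′ , ℕP.≤-trans (ℕP.n≤1+n a′) a≤c , inj₁ (trans (ℕP.∣-∣-comm (suc a′) a′) (∣n-1+n∣≡1 a′)) ,
                trans (offsetDist-down ∣ suc a′ - e ∣ (ℕP.≰⇒> far) (s≤s (∣-∣≤c (suc a′) e a≤c e≤c)))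
                      (cong (suc ∘ offsetDist) (∣suc-∣-< a′ e (ℕP.<-trans (ℕP.n<1+n a′) a<e)))
    cycleMetric-descent a e a≤c e≤c a≢e | tri> _ _ e<a with ∣ a - e ∣ ℕ.≤? k
    ...   | yes near with a
    ...     | suc a′ = a′ , ℕP.≤-trans (ℕP.n≤1+n a′) a≤c , inj₁ (trans (ℕP.∣-∣-comm (suc a′) a′) (∣n-1+n∣≡1 a′)) ,
                trans (cong offsetDist (∣suc-∣-≥ a′ e (ℕP.≤-pred e<a)))
                      (offsetDist-up ∣ a′ - e ∣ (subst (_≤ k) (∣suc-∣-≥ a′ e (ℕP.≤-pred e<a)) near))
    cycleMetric-descent a e a≤c e≤c a≢e | tri> _ _ e<a | no far with a ℕ.≟ c
    ...   | yes refl = 0 , z≤n , inj₂ (inj₂ (refl , refl)) ,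
                trans (cycleMetric-c e e≤c) (offsetDist-up e e<k)
      where
      e<k : e < k
      e<k with e ℕ.<? k
      ... | yes e<k = e<k
      ... | no  e≮k = contradiction (subst (k <_) (ℕP.m≤n⇒∣n-m∣≡n∸m e≤c) (ℕP.≰⇒> far))
                        (ℕP.≤⇒≯ (ℕP.≤-trans (ℕP.∸-monoʳ-≤ c (ℕP.≮⇒≥ e≮k)) (ℕP.≤-reflexive (ℕP.m+n∸m≡n k k))))
    ...   | no  a≢c  = suc a , ℕP.≤∧≢⇒< a≤c a≢c , inj₁ (∣n-1+n∣≡1 a) ,
                trans (offsetDist-down ∣ a - e ∣ (ℕP.≰⇒> far) (s≤s (∣-∣≤c a e a≤c e≤c)))
                      (cong (suc ∘ offsetDist) (sym (∣suc-∣-≥ a e (ℕP.<⇒≤ e<a))))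

    cycleMetric-positive : ∀ a b → a ≢ b → a ≤ c → b ≤ c → 1 ≤ cycleMetric a b
    cycleMetric-positive a b a≢b a≤c b≤c =
      offsetDist-positive ∣ a - b ∣ (ℕP.n≢0⇒n>0 (a≢b ∘ ℕP.∣m-n∣≡0⇒m≡n)) (s≤s (∣-∣≤c a b a≤c b≤c))

    cycleMetric-refl : ∀ a → cycleMetric a a ≡ 0
    cycleMetric-refl a = cong offsetDist (ℕP.∣n-n∣≡0 a)

    CycleAdjacent-irreflexive : c ≢ 0 → ∀ a → ¬ CycleAdjacent a a
    CycleAdjacent-irreflexive c≢0 a (inj₁ ∣a-a∣≡1)         = ℕP.0≢1+n (trans (sym (ℕP.∣n-n∣≡0 a)) ∣a-a∣≡1)
    CycleAdjacent-irreflexive c≢0 a (inj₂ (inj₁ (a≡0 , a≡c))) = c≢0 (trans (sym a≡c) a≡0)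
    CycleAdjacent-irreflexive c≢0 a (inj₂ (inj₂ (a≡c , a≡0))) = c≢0 (trans (sym a≡c) a≡0)

module StrideOrdering where

  open CycleMatrixDeterminant using (double; double≡+; cycDist; cycDist-even; cycDist-odd)
  open OddCycleMetric
  open import Data.Nat as ℕ using (ℕ; zero; suc; _<_; _≤_; z≤n; s≤s; ∣_-_∣; _∸_; _+_; pred)
  import Data.Nat.Properties as ℕP
  open import Data.Integer using (+_; _-_)
  import Data.Integer.Properties as ℤP
  open import Relation.Nullary using (yes; no)
  open import Relation.Nullary.Negation using (contradiction)
  open import Function using (_∘_)
  open import Relation.Binary.PropositionalEquality

  +∸ : ∀ {k w} → w ≤ k → + (k ∸ w) ≡ + k - + w
  +∸ {k} {w} w≤k = sym (trans (ℤP.m-n≡m⊖n k w) (ℤP.⊖-≥ w≤k))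

  data EvenOdd : ℕ → Set where
    even : ∀ v → EvenOdd (double v)
    odd  : ∀ v → EvenOdd (suc (double v))

  evenOdd : ∀ s → EvenOdd s
  evenOdd zero = even 0
  evenOdd (suc s) with evenOdd s
  ... | even v = odd v
  ... | odd  v = even (suc v)

  module Stride (k : ℕ) where
    open OddCycle k

    -- The s-th vertex in the ordering sits at position s·k (mod 2k+1) of the cycle.
    orderedPosition : ℕ → ℕ
    orderedPosition zero          = k
    orderedPosition (suc zero)    = c
    orderedPosition (suc (suc s)) = pred (orderedPosition s)

    orderedPosition-even : ∀ v → orderedPosition (double v) ≡ k ∸ v
    orderedPosition-even zero    = refl
    orderedPosition-even (suc v) = trans (cong pred (orderedPosition-even v)) (ℕP.pred[m∸n]≡m∸[1+n] k v)

    orderedPosition-odd : ∀ v → orderedPosition (suc (double v)) ≡ c ∸ v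
    orderedPosition-odd zero    = refl
    orderedPosition-odd (suc v) = trans (cong pred (orderedPosition-odd v)) (ℕP.pred[m∸n]≡m∸[1+n] c v)

    half-≤ : ∀ v → double v ≤ c → v ≤ k
    half-≤ v 2v≤c with v ℕ.≤? k
    ... | yes v≤k = v≤k
    ... | no  v≰k = contradiction (subst (_≤ c) (double≡+ v) 2v≤c) (ℕP.<⇒≱ (ℕP.+-mono-< (ℕP.≰⇒> v≰k) (ℕP.≰⇒> v≰k)))

    ∣k-[k∸w]∣ : ∀ w → w ≤ k → ∣ k - (k ∸ w) ∣ ≡ w
    ∣k-[k∸w]∣ w w≤k = trans (ℕP.m≤n⇒∣n-m∣≡n∸m (ℕP.m∸n≤m k w)) (ℕP.m∸[m∸n]≡n w≤k)

    cycleMetric-ordered₀ : ∀ t → t ≤ c → + cycleMetric k (orderedPosition t) ≡ cycDist k t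
    cycleMetric-ordered₀ t t≤c = by-parity (evenOdd t) t≤c
      where
      by-parity : ∀ {t} → EvenOdd t → t ≤ c → + cycleMetric k (orderedPosition t) ≡ cycDist k t
      by-parity (even w) t≤c = begin
        + offsetDist ∣ k - orderedPosition (double w) ∣  ≡⟨ cong (λ z → + offsetDist ∣ k - z ∣) (orderedPosition-even w) ⟩
        + offsetDist ∣ k - (k ∸ w) ∣                     ≡⟨ cong (+_ ∘ offsetDist) (∣k-[k∸w]∣ w w≤k) ⟩
        + offsetDist w                                    ≡⟨ cong +_ (offsetDist-≤k w w≤k) ⟩
        + w                                               ≡⟨ cycDist-even k w ⟨
        cycDist k (double w)                              ∎
        where
        open ≡-Reasoning
        w≤k : w ≤ k
        w≤k = half-≤ w t≤c
      by-parity (odd w) t≤c = begin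
        + offsetDist ∣ k - orderedPosition (suc (double w)) ∣ ≡⟨ cong (λ z → + offsetDist ∣ k - z ∣) (trans (orderedPosition-odd w) (ℕP.+-∸-assoc k w≤k)) ⟩
        + offsetDist ∣ k - (k + (k ∸ w)) ∣                   ≡⟨ cong (λ z → + offsetDist z) (ℕP.∣m-m+n∣≡n k (k ∸ w)) ⟩
        + offsetDist (k ∸ w)                                 ≡⟨ cong +_ (offsetDist-≤k (k ∸ w) (ℕP.m∸n≤m k w)) ⟩
        + (k ∸ w)                                            ≡⟨ +∸ w≤k ⟩
        + k - + w                                            ≡⟨ cycDist-odd k w ⟨
        cycDist k (suc (double w))                           ∎
        where
        open ≡-Reasoning
        w≤k : w ≤ k
        w≤k = half-≤ w (ℕP.≤-trans (ℕP.n≤1+n _) t≤c)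

    cycleMetric-ordered₁ : ∀ t → t ≤ c → + cycleMetric c (orderedPosition t) ≡ cycDist k ∣ 1 - t ∣
    cycleMetric-ordered₁ t t≤c = by-parity (evenOdd t) t≤c
      where
      open ≡-Reasoning
      by-parity : ∀ {t} → EvenOdd t → t ≤ c → + cycleMetric c (orderedPosition t) ≡ cycDist k ∣ 1 - t ∣
      by-parity (even zero) _ =
        cong +_ (trans (cong offsetDist (trans (ℕP.∣-∣-comm c k) (ℕP.∣m-m+n∣≡n k k))) (offsetDist-≤k k ℕP.≤-refl))
      by-parity (even (suc w)) t≤c = begin
        + offsetDist ∣ c - orderedPosition (double (suc w)) ∣  ≡⟨ cong (λ z → + offsetDist ∣ c - z ∣) (orderedPosition-even (suc w)) ⟩
        + offsetDist ∣ c - (k ∸ suc w) ∣                       ≡⟨ cong (+_ ∘ offsetDist) distance ⟩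
        + offsetDist (k + suc w)                               ≡⟨ cong +_ wrapped ⟩
        + (k ∸ w)                                              ≡⟨ +∸ (ℕP.<⇒≤ w<k) ⟩
        + k - + w                                              ≡⟨ cycDist-odd k w ⟨
        cycDist k (suc (double w))                             ∎
        where
        w<k : w < k
        w<k = half-≤ (suc w) t≤c
        distance : ∣ c - (k ∸ suc w) ∣ ≡ k + suc w
        distance = trans (ℕP.m≤n⇒∣n-m∣≡n∸m (ℕP.≤-trans (ℕP.m∸n≤m k (suc w)) (ℕP.m≤m+n k k)))
                         (trans (ℕP.+-∸-assoc k (ℕP.m∸n≤m k (suc w))) (cong (ℕ._+_ k) (ℕP.m∸[m∸n]≡n w<k)))
        wrapped : offsetDist (k + suc w) ≡ k ∸ w
        wrapped = trans (offsetDist->k (k + suc w) (ℕP.m<m+n k (s≤s z≤n)))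
                        (trans (cong (_∸ (k + suc w)) (sym (ℕP.+-suc k k))) (ℕP.[m+n]∸[m+o]≡n∸o k (suc k) (suc w)))
      by-parity (odd w) t≤c = begin
        + offsetDist ∣ c - orderedPosition (suc (double w)) ∣  ≡⟨ cong (λ z → + offsetDist ∣ c - z ∣) (orderedPosition-odd w) ⟩
        + offsetDist ∣ c - (c ∸ w) ∣                           ≡⟨ cong (+_ ∘ offsetDist) (trans (ℕP.m≤n⇒∣n-m∣≡n∸m (ℕP.m∸n≤m c w))
                                                                                                (ℕP.m∸[m∸n]≡n (ℕP.≤-trans w≤k (ℕP.m≤m+n k k)))) ⟩
        + offsetDist w                                         ≡⟨ cong +_ (offsetDist-≤k w w≤k) ⟩
        + w                                                    ≡⟨ cycDist-even k w ⟨
        cycDist k (double w)                                   ∎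
        where
        w≤k : w ≤ k
        w≤k = half-≤ w (ℕP.≤-trans (ℕP.n≤1+n _) t≤c)

    orderedPosition-positive : ∀ s → suc (suc s) ≤ c → 0 < orderedPosition s
    orderedPosition-positive s s+2≤c = by-parity (evenOdd s) s+2≤c
      where
      by-parity : ∀ {s} → EvenOdd s → suc (suc s) ≤ c → 0 < orderedPosition s
      by-parity (even v) s+2≤c = subst (0 <_) (sym (orderedPosition-even v)) (ℕP.m<n⇒0<n∸m (half-≤ (suc v) s+2≤c))
      by-parity (odd v)  s+3≤c = subst (0 <_) (sym (orderedPosition-odd v))
        (ℕP.m<n⇒0<n∸m (ℕP.<-≤-trans (s≤s (ℕP.≤-trans (ℕP.m≤n+m v v) (ℕP.≤-reflexive (sym (double≡+ v)))))
                                     (ℕP.≤-trans (ℕP.n≤1+n _) (ℕP.≤-trans (ℕP.n≤1+n _) s+3≤c))))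

    cycleMetric-ordered : ∀ s t → s ≤ c → t ≤ c → + cycleMetric (orderedPosition s) (orderedPosition t) ≡ cycDist k ∣ s - t ∣
    cycleMetric-ordered zero          t             _ t≤c = cycleMetric-ordered₀ t t≤c
    cycleMetric-ordered (suc zero)    t             _ t≤c = cycleMetric-ordered₁ t t≤c
    cycleMetric-ordered (suc (suc s)) zero          s≤c _ =
      trans (cong (+_ ∘ offsetDist) (ℕP.∣-∣-comm (orderedPosition (suc (suc s))) k)) (cycleMetric-ordered₀ (suc (suc s)) s≤c)
    cycleMetric-ordered (suc (suc s)) (suc zero)    s≤c _ =
      trans (cong (+_ ∘ offsetDist) (ℕP.∣-∣-comm (orderedPosition (suc (suc s))) c))
            (trans (cycleMetric-ordered₁ (suc (suc s)) s≤c) (cong (cycDist k) (ℕP.∣-∣-comm 1 (suc (suc s)))))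
    cycleMetric-ordered (suc (suc s)) (suc (suc t)) s≤c t≤c =
      trans (cong (+_ ∘ offsetDist) (∣pred-pred∣ (orderedPosition-positive s s≤c) (orderedPosition-positive t t≤c)))
            (cycleMetric-ordered s t (ℕP.≤-trans (ℕP.n≤1+n s) (ℕP.≤-trans (ℕP.n≤1+n _) s≤c))
                                     (ℕP.≤-trans (ℕP.n≤1+n t) (ℕP.≤-trans (ℕP.n≤1+n _) t≤c)))
      where
      ∣pred-pred∣ : ∀ {x y} → 0 < x → 0 < y → ∣ pred x - pred y ∣ ≡ ∣ x - y ∣
      ∣pred-pred∣ {suc x} {suc y} _ _ = refl

    orderedPosition-≤ : ∀ s → orderedPosition s ≤ c
    orderedPosition-≤ s = by-parity (evenOdd s)
      where
      by-parity : ∀ {s} → EvenOdd s → orderedPosition s ≤ c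
      by-parity (even v) = subst (_≤ c) (sym (orderedPosition-even v)) (ℕP.≤-trans (ℕP.m∸n≤m k v) (ℕP.m≤m+n k k))
      by-parity (odd v)  = subst (_≤ c) (sym (orderedPosition-odd v)) (ℕP.m∸n≤m c v)

    orderedPosition-c : orderedPosition c ≡ 0
    orderedPosition-c = trans (cong orderedPosition (sym (double≡+ k))) (trans (orderedPosition-even k) (ℕP.n∸n≡0 k))

    cycDist≡0 : ∀ u → u ≤ c → cycDist k u ≡ + 0 → u ≡ 0
    cycDist≡0 u u≤c = by-parity (evenOdd u) u≤c
      where
      by-parity : ∀ {u} → EvenOdd u → u ≤ c → cycDist k u ≡ + 0 → u ≡ 0
      by-parity (even zero)    _ _ = refl
      by-parity (even (suc w)) _ e with trans (sym (cycDist-even k (suc w))) e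
      ... | ()
      by-parity (odd w) u≤c e = contradiction (ℤP.+-injective (trans (+∸ (ℕP.<⇒≤ w<k)) (trans (sym (cycDist-odd k w)) e)))
                                              (ℕP.<⇒≢ (ℕP.m<n⇒0<n∸m w<k) ∘ sym)
        where
        w<k : w < k
        w<k with w ℕ.<? k
        ... | yes w<k = w<k
        ... | no  w≮k = contradiction (ℕP.+-mono-≤ (ℕP.≮⇒≥ w≮k) (ℕP.≮⇒≥ w≮k))
                                      (ℕP.<⇒≱ (subst (λ z → suc z ≤ c) (double≡+ w) u≤c))

    orderedPosition-injective : ∀ s t → s ≤ c → t ≤ c → orderedPosition s ≡ orderedPosition t → s ≡ t
    orderedPosition-injective s t s≤c t≤c eq = ℕP.∣m-n∣≡0⇒m≡n (cycDist≡0 ∣ s - t ∣ (∣-∣≤c s t s≤c t≤c)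
      (trans (sym (cycleMetric-ordered s t s≤c t≤c))
             (cong +_ (trans (cong (λ z → cycleMetric z (orderedPosition t)) eq) (cong offsetDist (ℕP.∣n-n∣≡0 (orderedPosition t)))))))

module PathMetric where

  open import Defs
  open import Data.Nat as ℕ using (ℕ; zero; suc; _≤_; z≤n; s≤s; _≡ᵇ_)
  import Data.Nat.Properties as ℕP
  open import Data.Bool using (Bool; true; false; T; _∧_)
  open import Data.Bool.Properties using (T-∨; T-∧)
  open import Data.Bool.ListAction using (any)
  open import Data.Fin using (Fin; toℕ)
  open import Data.Fin.Properties using (toℕ-injective)
  open import Data.List using (allFin)
  open import Data.List.Membership.Propositional using (_∈_)
  open import Data.List.Membership.Propositional.Properties using (∈-allFin)
  import Data.List.Relation.Unary.Any as Any
  open import Data.List.Relation.Unary.Any.Properties using (any⁺; any⁻)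
  open import Data.Product using (∃-syntax; _×_; _,_)
  open import Data.Sum using (inj₁; inj₂)
  open import Function using (_∘_)
  open import Function.Bundles using (Equivalence)
  open import Relation.Nullary using (yes; no)
  open import Relation.Binary.PropositionalEquality

  any-intro : ∀ {A : Set} (p : A → Bool) {xs} x → x ∈ xs → T (p x) → T (any p xs)
  any-intro p x x∈xs px = any⁺ p (Any.map (λ x≡y → subst (T ∘ p) x≡y px) x∈xs)

  module DistanceCharacterisation {N : ℕ} (adj : Fin N → Fin N → Bool) (d : Fin N → Fin N → ℕ)
    (d≡0⇒≡ : ∀ x y → d x y ≡ 0 → x ≡ y)
    (d-refl : ∀ x → d x x ≡ 0)
    (d-edge : ∀ x y z → T (adj x z) → d x y ≤ suc (d z y))
    (d-step : ∀ x y e → d x y ≡ suc e → ∃[ z ] T (adj x z) × d z y ≡ e)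
    (d≤N : ∀ x y → d x y ≤ N)
    where

    walkWithin⇒ : ∀ ℓ x y → T (walkWithin adj ℓ x y) → d x y ≤ ℓ
    walkWithin⇒ zero    x y w = ℕP.≤-reflexive (trans (cong (d x) (sym x≡y)) (d-refl x))
      where
      x≡y : x ≡ y
      x≡y = toℕ-injective (ℕP.≡ᵇ⇒≡ (toℕ x) (toℕ y) w)
    walkWithin⇒ (suc ℓ) x y w with Equivalence.to T-∨ w
    ... | inj₁ shorter = ℕP.m≤n⇒m≤1+n (walkWithin⇒ ℓ x y shorter)
    ... | inj₂ viaNeighbour with Any.satisfied (any⁻ _ (allFin N) viaNeighbour)
    ...   | z , adj∧w with Equivalence.to T-∧ adj∧w
    ...     | xz , zy = ℕP.≤-trans (d-edge x y z xz) (s≤s (walkWithin⇒ ℓ z y zy))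

    walkWithin⇐ : ∀ ℓ x y → d x y ≤ ℓ → T (walkWithin adj ℓ x y)
    walkWithin⇐ zero    x y d≤0 = ℕP.≡⇒≡ᵇ (toℕ x) (toℕ y) (cong toℕ (d≡0⇒≡ x y (ℕP.n≤0⇒n≡0 d≤0)))
    walkWithin⇐ (suc ℓ) x y d≤1+ℓ with d x y ℕ.≤? ℓ
    ... | yes d≤ℓ = Equivalence.from T-∨ (inj₁ (walkWithin⇐ ℓ x y d≤ℓ))
    ... | no  d≰ℓ with d-step x y ℓ (ℕP.≤-antisym d≤1+ℓ (ℕP.≰⇒> d≰ℓ))
    ...   | z , xz , dzy = Equivalence.from T-∨ (inj₂ (any-intro (λ z → adj x z ∧ walkWithin adj ℓ z y) z (∈-allFin z)
                                (Equivalence.from T-∧ (xz , walkWithin⇐ ℓ z y (ℕP.≤-reflexive dzy)))))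

    leastFrom≡ : ∀ fuel start x y → start ≤ d x y → d x y ≤ start ℕ.+ fuel → leastFrom adj fuel start x y ≡ d x y
    leastFrom≡ zero start x y start≤d d≤start =
      ℕP.≤-antisym start≤d (subst (d x y ≤_) (ℕP.+-identityʳ start) d≤start)
    leastFrom≡ (suc fuel) start x y start≤d d≤end
      with walkWithin adj start x y | walkWithin⇒ start x y | walkWithin⇐ start x y
    ... | true  | found | _ = ℕP.≤-antisym start≤d (found _)
    ... | false | _ | notFound = leastFrom≡ fuel (suc start) x y
            (ℕP.≰⇒> notFound) (subst (d x y ≤_) (ℕP.+-suc start fuel) d≤end)

    distance≡ : ∀ x y → distance adj x y ≡ d x y
    distance≡ x y = leastFrom≡ N 0 x y z≤n (d≤N x y)

module TwinGraphDistance where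

  open import Defs
  open OddCycleMetric
  open import Data.Nat as ℕ using (ℕ; zero; suc; _<_; _≤_; z≤n; s≤s; _≡ᵇ_; _+_; _∸_; ∣_-_∣)
  import Data.Nat.Properties as ℕP
  open import Data.Nat.ListAction using (sum)
  open import Data.Bool using (T; _∧_)
  open import Data.Bool.Properties using (T-∨; T-∧)
  open import Data.List using (List; []; _∷_; _++_; replicate)
  open import Data.Fin using (Fin; toℕ; fromℕ<)
  open import Data.Fin.Properties using (toℕ<n; toℕ-fromℕ<; toℕ-injective)
  open import Data.Integer using (+_)
  open import Data.List.Membership.Propositional using (_∈_)
  open import Data.List.Membership.Propositional.Properties using (∈-++⁺ˡ; ∈-++⁺ʳ)
  open import Data.List.Relation.Unary.Any using (here; there)
  open import Data.List.Relation.Unary.All as All using (All; []; _∷_)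
  open import Data.List.Relation.Unary.All.Properties using (++⁺)
  open import Data.Product using (Σ-syntax; ∃-syntax; _×_; _,_; proj₁; proj₂)
  open import Data.Sum as Sum using (_⊎_; inj₁; inj₂)
  open import Function using (_∘_)
  open import Function.Bundles using (Equivalence)
  open import Relation.Nullary using (Dec; yes; no)
  open import Relation.Nullary.Negation using (contradiction)
  open import Relation.Binary.PropositionalEquality
  open PathMetric using (any-intro; module DistanceCharacterisation)

  adjacent-edge : ∀ es a b → (a , b) ∈ es → T (adjacent es a b)
  adjacent-edge es a b ab∈es = any-intro _ (a , b) ab∈es
    (Equivalence.from T-∨ (inj₁ (Equivalence.from T-∧ (ℕP.≡⇒≡ᵇ a a refl , ℕP.≡⇒≡ᵇ b b refl))))

  adjacent-edgeʳ : ∀ es a b → (a , b) ∈ es → T (adjacent es b a)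
  adjacent-edgeʳ es a b ab∈es = any-intro _ (a , b) ab∈es
    (Equivalence.from T-∨ (inj₂ (Equivalence.from T-∧ (ℕP.≡⇒≡ᵇ a a refl , ℕP.≡⇒≡ᵇ b b refl))))

  ≡ᵇ-pair : ∀ {a b u v} → T ((a ≡ᵇ u) ∧ (b ≡ᵇ v)) → (u , v) ≡ (a , b)
  ≡ᵇ-pair {a} {b} {u} {v} t with Equivalence.to T-∧ t
  ... | a≡u , b≡v = sym (cong₂ _,_ (ℕP.≡ᵇ⇒≡ a u a≡u) (ℕP.≡ᵇ⇒≡ b v b≡v))

  adjacent⇒edge : ∀ es x y → T (adjacent es x y) → ((x , y) ∈ es) ⊎ ((y , x) ∈ es)
  adjacent⇒edge ((a , b) ∷ es) x y xy with Equivalence.to T-∨ xy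
  ... | inj₂ later = Sum.map there there (adjacent⇒edge es x y later)
  ... | inj₁ now with Equivalence.to T-∨ now
  ...   | inj₁ ab≡xy = inj₁ (here (≡ᵇ-pair ab≡xy))
  ...   | inj₂ ab≡yx = inj₂ (here (≡ᵇ-pair ab≡yx))

  adjacent-sym : ∀ es x y → T (adjacent es x y) → T (adjacent es y x)
  adjacent-sym es x y xy with adjacent⇒edge es x y xy
  ... | inj₁ xy∈es = adjacent-edgeʳ es x y xy∈es
  ... | inj₂ yx∈es = adjacent-edge es y x yx∈es

  adjacent-sound : (P : ℕ → ℕ → Set) → (∀ {a b} → P a b → P b a) →
    ∀ es → All (λ e → P (proj₁ e) (proj₂ e)) es → ∀ x y → T (adjacent es x y) → P x y
  adjacent-sound P P-sym es all-P x y xy with adjacent⇒edge es x y xy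
  ... | inj₁ xy∈es = All.lookup all-P xy∈es
  ... | inj₂ yx∈es = P-sym (All.lookup all-P yx∈es)

  twinEdges : ℕ → ℕ → List (ℕ × ℕ)
  twinEdges off zero    = []
  twinEdges off (suc R) = (2 , off) ∷ (off , 0) ∷ twinEdges (off + 1) R

  branchEdges-twins : ∀ R off ys → branchEdges 2 off (replicate R 1 ++ ys) ≡ twinEdges off R ++ branchEdges 2 (off + R) ys
  branchEdges-twins zero    off ys = cong (λ o → branchEdges 2 o ys) (sym (ℕP.+-identityʳ off))
  branchEdges-twins (suc R) off ys = cong (λ es → (2 , off) ∷ (off , 0) ∷ es)
    (trans (branchEdges-twins R (off + 1) ys) (cong (λ o → twinEdges (off + 1) R ++ branchEdges 2 o ys) (ℕP.+-assoc off 1 R)))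

  twinEdges-top : ∀ R off i → i < R → (2 , off + i) ∈ twinEdges off R
  twinEdges-top (suc R) off zero    _         = here (cong (2 ,_) (ℕP.+-identityʳ off))
  twinEdges-top (suc R) off (suc i) (s≤s i<R) =
    there (there (subst (λ z → (2 , z) ∈ twinEdges (off + 1) R) (ℕP.+-assoc off 1 i) (twinEdges-top R (off + 1) i i<R)))

  twinEdges-bottom : ∀ R off i → i < R → (off + i , 0) ∈ twinEdges off R
  twinEdges-bottom (suc R) off zero    _         = there (here (cong (_, 0) (ℕP.+-identityʳ off)))
  twinEdges-bottom (suc R) off (suc i) (s≤s i<R) =
    there (there (subst (λ z → (z , 0) ∈ twinEdges (off + 1) R) (ℕP.+-assoc off 1 i) (twinEdges-bottom R (off + 1) i i<R)))

  pathEdges-step : ∀ m off j → j < m → (j + off , suc j + off) ∈ pathEdges (block off (suc m) ++ (0 ∷ []))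
  pathEdges-step (suc m) off zero    _         = here refl
  pathEdges-step (suc m) off (suc j) (s≤s j<m) =
    there (subst (λ z → (z , suc z) ∈ pathEdges (block (suc off) (suc m) ++ (0 ∷ []))) (ℕP.+-suc j off) (pathEdges-step m (suc off) j j<m))

  pathEdges-last : ∀ m off → (m + off , 0) ∈ pathEdges (block off (suc m) ++ (0 ∷ []))
  pathEdges-last zero    off = here refl
  pathEdges-last (suc m) off =
    there (subst (λ z → (z , 0) ∈ pathEdges (block (suc off) (suc m) ++ (0 ∷ []))) (ℕP.+-suc m off) (pathEdges-last m (suc off)))

  -- The graph C(2; 1, …, 1, K₁+1) with R branches of length 1; its big cycle has length 2k+1.
  module TwinGraph (k R K₁ : ℕ) (k+k≡ : k + k ≡ suc (suc (suc K₁))) where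
    open OddCycle k

    ms : List ℕ
    ms = replicate R 1 ++ (suc K₁ ∷ [])

    -- Vertex numbering: u₀, u₁, u₂ are 0, 1, 2; the R twins are 3, …, 2+R; the long branch starts at X.
    X : ℕ
    X = suc (suc (suc R))

    es : List (ℕ × ℕ)
    es = edgesC 2 ms

    es-shape : es ≡ (0 , 1) ∷ (1 , 2) ∷ (twinEdges 3 R ++ ((2 , X) ∷ pathEdges (block X (suc K₁) ++ (0 ∷ [])) ++ []))
    es-shape = cong (λ e → (0 , 1) ∷ (1 , 2) ∷ e) (branchEdges-twins R 3 (suc K₁ ∷ []))

    N : ℕ
    N = suc (suc (suc (R + suc K₁)))

    numVertices≡N : numVertices 2 ms ≡ N
    numVertices≡N = cong (suc ∘ suc ∘ suc) (sum-ms R)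
      where
      sum-ms : ∀ R → sum (replicate R 1 ++ (suc K₁ ∷ [])) ≡ R + suc K₁
      sum-ms zero    = ℕP.+-identityʳ (suc K₁)
      sum-ms (suc R) = cong suc (sum-ms R)

    edge : ∀ {a b} → (a , b) ∈ (0 , 1) ∷ (1 , 2) ∷ (twinEdges 3 R ++ ((2 , X) ∷ pathEdges (block X (suc K₁) ++ (0 ∷ [])) ++ [])) →
      T (adjacent es a b)
    edge {a} {b} ab∈ = adjacent-edge es a b (subst ((a , b) ∈_) (sym es-shape) ab∈)

    edge₀₁ : T (adjacent es 0 1)
    edge₀₁ = edge (here refl)
    edge₁₂ : T (adjacent es 1 2)
    edge₁₂ = edge (there (here refl))
    edge-twinTop : ∀ i → i < R → T (adjacent es 2 (3 + i))
    edge-twinTop i i<R = edge (there (there (∈-++⁺ˡ (twinEdges-top R 3 i i<R))))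
    edge-twinBottom : ∀ i → i < R → T (adjacent es (3 + i) 0)
    edge-twinBottom i i<R = edge (there (there (∈-++⁺ˡ (twinEdges-bottom R 3 i i<R))))
    edge-longFirst : T (adjacent es 2 X)
    edge-longFirst = edge (there (there (∈-++⁺ʳ (twinEdges 3 R) (here refl))))
    edge-longStep : ∀ j → j < K₁ → T (adjacent es (j + X) (suc j + X))
    edge-longStep j j<K₁ = edge (there (there (∈-++⁺ʳ (twinEdges 3 R) (there (∈-++⁺ˡ (pathEdges-step K₁ X j j<K₁))))))
    edge-longLast : T (adjacent es (K₁ + X) 0)
    edge-longLast = edge (there (there (∈-++⁺ʳ (twinEdges 3 R) (there (∈-++⁺ˡ (pathEdges-last K₁ X))))))

    position : ℕ → ℕ
    position zero                = c
    position (suc zero)          = 0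
    position (suc (suc zero))    = 1
    position (suc (suc (suc y))) with y ℕ.<? R
    ... | yes _ = 0
    ... | no  _ = suc (suc (y ∸ R))

    position-twin : ∀ i → i < R → position (3 + i) ≡ 0
    position-twin i i<R with i ℕ.<? R
    ... | yes _   = refl
    ... | no  i≮R = contradiction i<R i≮R

    long≡ : ∀ i → i + X ≡ 3 + (i + R)
    long≡ i = trans (ℕP.+-suc i (suc (suc R))) (cong suc (trans (ℕP.+-suc i (suc R)) (cong suc (ℕP.+-suc i R))))

    position-beyondTwins : ∀ y → R ≤ y → position (3 + y) ≡ suc (suc (y ∸ R))
    position-beyondTwins y R≤y with y ℕ.<? R
    ... | yes y<R = contradiction R≤y (ℕP.<⇒≱ y<R)
    ... | no  _   = refl

    position-long : ∀ i → position (i + X) ≡ suc (suc i)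
    position-long i = trans (cong position (long≡ i))
      (trans (position-beyondTwins (i + R) (ℕP.m≤n+m R i)) (cong (suc ∘ suc) (ℕP.m+n∸n≡m i R)))

    data Vertex : ℕ → Set where
      u₀   : Vertex 0
      u₁   : Vertex 1
      u₂   : Vertex 2
      twin : ∀ i → i < R → Vertex (3 + i)
      long : ∀ i → i ≤ K₁ → Vertex (i + X)

    vertex : ∀ x → x < N → Vertex x
    vertex zero                _ = u₀
    vertex (suc zero)          _ = u₁
    vertex (suc (suc zero))    _ = u₂
    vertex (suc (suc (suc y))) (s≤s (s≤s (s≤s y<))) with y ℕ.<? R
    ... | yes y<R = twin y y<R
    ... | no  y≮R = subst Vertex (trans (long≡ (y ∸ R)) (cong (suc ∘ suc ∘ suc) (ℕP.m∸n+n≡m R≤y)))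
                          (long (y ∸ R) (ℕP.≤-pred (ℕP.+-cancelʳ-< R (y ∸ R) (suc K₁)
                                          (subst (_< suc K₁ + R) (sym (ℕP.m∸n+n≡m R≤y)) (subst (y <_) (ℕP.+-comm R (suc K₁)) y<)))))
      where
      R≤y : R ≤ y
      R≤y = ℕP.≮⇒≥ y≮R

    c≡ : c ≡ suc (suc (suc K₁))
    c≡ = k+k≡

    position-≤ : ∀ x → x < N → position x ≤ c
    position-≤ x x<N with vertex x x<N
    ... | u₀         = ℕP.≤-refl
    ... | u₁         = z≤n
    ... | u₂         = subst (1 ≤_) (sym c≡) (s≤s z≤n)
    ... | twin i i<R = subst (_≤ c) (sym (position-twin i i<R)) z≤n
    ... | long i i≤K = subst₂ _≤_ (sym (position-long i)) (sym c≡) (s≤s (s≤s (ℕP.m≤n⇒m≤1+n i≤K)))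

    Adj : ℕ → ℕ → Set
    Adj a b = CycleAdjacent (position a) (position b)

    edges-cycleAdjacent : All (λ e → Adj (proj₁ e) (proj₂ e)) es
    edges-cycleAdjacent = subst (All (λ e → Adj (proj₁ e) (proj₂ e))) (sym es-shape)
      (inj₂ (inj₂ (refl , refl)) ∷ inj₁ refl ∷ ++⁺ (twins R 0 ℕP.≤-refl) (inj₁ (cong (λ z → ∣ 1 - z ∣) (position-long 0)) ∷ ++⁺ (longPath K₁ 0 refl) []))
      where
      twins : ∀ n i → i + n ≤ R → All (λ e → Adj (proj₁ e) (proj₂ e)) (twinEdges (3 + i) n)
      twins zero    i _ = []
      twins (suc n) i i+n<R = inj₁ (cong (λ z → ∣ 1 - z ∣) (position-twin i i<R)) ∷ inj₂ (inj₁ (position-twin i i<R , refl))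
                              ∷ twins n (i + 1) (subst (_≤ R) (sym (ℕP.+-assoc i 1 n)) i+n<R)
        where
        i<R : i < R
        i<R = ℕP.<-≤-trans (ℕP.m<m+n i (s≤s z≤n)) i+n<R
      longPath : ∀ m i → i + m ≡ K₁ → All (λ e → Adj (proj₁ e) (proj₂ e)) (pathEdges (block (i + X) (suc m) ++ (0 ∷ [])))
      longPath zero    i i≡K₁ = inj₁ (trans (cong₂ (λ u v → ∣ u - v ∣) (position-long i) c≡)
                                            (subst (λ z → ∣ suc (suc i) - suc (suc (suc z)) ∣ ≡ 1) (trans (sym (ℕP.+-identityʳ i)) i≡K₁)
                                                   (∣n-1+n∣≡1 i))) ∷ []
      longPath (suc m) i i+m≡K₁ = inj₁ (trans (cong₂ (λ u v → ∣ u - v ∣) (position-long i) (position-long (suc i))) (∣n-1+n∣≡1 i))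
                                  ∷ longPath m (suc i) (trans (sym (ℕP.+-suc i m)) i+m≡K₁)

    adjacent⇒cycleAdjacent : ∀ x y → T (adjacent es x y) → Adj x y
    adjacent⇒cycleAdjacent = adjacent-sound Adj CycleAdjacent-sym es edges-cycleAdjacent

    vertexAt : ℕ → ℕ
    vertexAt zero          = 1
    vertexAt (suc zero)    = 2
    vertexAt (suc (suc i)) with i ℕ.≤? K₁
    ... | yes _ = i + X
    ... | no  _ = 0

    vertexAt-long : ∀ i → i ≤ K₁ → vertexAt (suc (suc i)) ≡ i + X
    vertexAt-long i i≤K₁ with i ℕ.≤? K₁
    ... | yes _   = refl
    ... | no  i≰K = contradiction i≤K₁ i≰K

    vertexAt-last : ∀ i → K₁ < i → vertexAt (suc (suc i)) ≡ 0
    vertexAt-last i K₁<i with i ℕ.≤? K₁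
    ... | yes i≤K = contradiction i≤K (ℕP.<⇒≱ K₁<i)
    ... | no  _   = refl

    vertexAt-c : vertexAt c ≡ 0
    vertexAt-c = trans (cong vertexAt c≡) (vertexAt-last (suc K₁) ℕP.≤-refl)

    position-vertexAt : ∀ q → q ≤ c → position (vertexAt q) ≡ q
    position-vertexAt zero          _   = refl
    position-vertexAt (suc zero)    _   = refl
    position-vertexAt (suc (suc i)) q≤c with i ℕ.≤? K₁
    ... | yes _   = position-long i
    ... | no  i≰K = trans c≡ (cong (suc ∘ suc) (sym (ℕP.≤-antisym (ℕP.≤-pred (ℕP.≤-pred (subst (suc (suc i) ≤_) c≡ q≤c))) (ℕP.≰⇒> i≰K))))

    vertexAt-< : ∀ q → vertexAt q < N
    vertexAt-< zero          = s≤s (s≤s z≤n)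
    vertexAt-< (suc zero)    = s≤s (s≤s (s≤s z≤n))
    vertexAt-< (suc (suc i)) with i ℕ.≤? K₁
    ... | yes i≤K = subst (_< N) (sym (long≡ i)) (s≤s (s≤s (s≤s (subst (_< R + suc K₁) (ℕP.+-comm R i) (ℕP.+-monoʳ-< R (s≤s i≤K))))))
    ... | no  _   = s≤s z≤n

    position-determines : ∀ x → x < N → position x ≢ 0 → x ≡ vertexAt (position x)
    position-determines x x<N p≢0 with vertex x x<N
    ... | u₀         = sym vertexAt-c
    ... | u₁         = contradiction refl p≢0
    ... | u₂         = refl
    ... | twin i i<R = contradiction (position-twin i i<R) p≢0
    ... | long i i≤K = trans (sym (vertexAt-long i i≤K)) (cong vertexAt (sym (position-long i)))

    c≢0 : c ≢ 0
    c≢0 c≡0 = ℕP.1+n≢0 (trans (sym c≡) c≡0)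

    position-zero : ∀ x → x < N → position x ≡ 0 → (x ≡ 1) ⊎ (∃[ i ] i < R × x ≡ 3 + i)
    position-zero x x<N p≡0 with vertex x x<N
    ... | u₀         = contradiction p≡0 c≢0
    ... | u₁         = inj₁ refl
    ... | u₂         = contradiction p≡0 ℕP.1+n≢0
    ... | twin i i<R = inj₂ (i , i<R , refl)
    ... | long i _   = contradiction (trans (sym (position-long i)) p≡0) ℕP.1+n≢0

    consecutive-adjacent : ∀ q → suc (suc q) ≤ c → T (adjacent es (vertexAt (suc q)) (vertexAt (suc (suc q))))
    consecutive-adjacent zero    _     = subst (T ∘ adjacent es 2) (sym (vertexAt-long 0 z≤n)) edge-longFirst
    consecutive-adjacent (suc i) i+3≤c with i ℕ.≤? K₁ | suc i ℕ.≤? K₁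
    ... | yes _   | yes i<K₁ = edge-longStep i i<K₁
    ... | yes i≤K | no  i≮K₁ = subst (λ j → T (adjacent es (j + X) 0)) (ℕP.≤-antisym (ℕP.≮⇒≥ i≮K₁) i≤K) edge-longLast
    ... | no  i≰K | _        = contradiction (ℕP.≤-pred (ℕP.≤-pred (ℕP.≤-pred (subst (3 + i ≤_) c≡ i+3≤c)))) i≰K

    successor-adjacent : ∀ x z → x < N → z < N → position z ≡ suc (position x) → T (adjacent es x z)
    successor-adjacent x z x<N z<N pz≡ =
      subst (T ∘ adjacent es x) (sym (trans (position-determines z z<N (λ pz≡0 → ℕP.1+n≢0 (trans (sym pz≡) pz≡0))) (cong vertexAt pz≡)))
            (by-cases (position x ℕ.≟ 0))
      where
      by-cases : Dec (position x ≡ 0) → T (adjacent es x (vertexAt (suc (position x))))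
      by-cases (yes px≡0) with position-zero x x<N px≡0
      ... | inj₁ refl             = edge₁₂
      ... | inj₂ (i , i<R , refl) = subst (λ p → T (adjacent es (3 + i) (vertexAt (suc p)))) (sym px≡0)
                                          (adjacent-sym es 2 (3 + i) (edge-twinTop i i<R))
      by-cases (no  px≢0) = subst (λ y → T (adjacent es y (vertexAt (suc (position x))))) (sym (position-determines x x<N px≢0))
                                  (from-nonzero (position x) px≢0 (subst (_≤ c) pz≡ (position-≤ z z<N)))
        where
        from-nonzero : ∀ p → p ≢ 0 → suc p ≤ c → T (adjacent es (vertexAt p) (vertexAt (suc p)))
        from-nonzero zero    p≢0 _      = contradiction refl p≢0
        from-nonzero (suc p) _   p+2≤c  = consecutive-adjacent p p+2≤c

    wrap-adjacent : ∀ x z → x < N → z < N → position x ≡ 0 → position z ≡ c → T (adjacent es x z)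
    wrap-adjacent x z x<N z<N px≡0 pz≡c =
      subst (T ∘ adjacent es x) (sym (trans (position-determines z z<N (λ pz≡0 → c≢0 (trans (sym pz≡c) pz≡0)))
                                            (trans (cong vertexAt pz≡c) vertexAt-c)))
            (by-cases (position-zero x x<N px≡0))
      where
      by-cases : (x ≡ 1) ⊎ (∃[ i ] i < R × x ≡ 3 + i) → T (adjacent es x 0)
      by-cases (inj₁ refl)             = adjacent-sym es 0 1 edge₀₁
      by-cases (inj₂ (i , i<R , refl)) = edge-twinBottom i i<R

    cycleAdjacent⇒adjacent : ∀ x z → x < N → z < N → Adj x z → T (adjacent es x z)
    cycleAdjacent⇒adjacent x z x<N z<N (inj₁ ∣px-pz∣≡1) with ∣-∣≡1 {position x} {position z} ∣px-pz∣≡1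
    ... | inj₁ pz≡ = successor-adjacent x z x<N z<N pz≡
    ... | inj₂ px≡ = adjacent-sym es z x (successor-adjacent z x z<N x<N px≡)
    cycleAdjacent⇒adjacent x z x<N z<N (inj₂ (inj₁ (px≡0 , pz≡c))) = wrap-adjacent x z x<N z<N px≡0 pz≡c
    cycleAdjacent⇒adjacent x z x<N z<N (inj₂ (inj₂ (px≡c , pz≡0))) = adjacent-sym es z x (wrap-adjacent z x z<N x<N pz≡0 px≡c)

    graphDist : ℕ → ℕ → ℕ
    graphDist x y with x ℕ.≟ y | position x ℕ.≟ position y
    ... | yes _ | _     = 0
    ... | no  _ | yes _ = 2
    ... | no  _ | no  _ = cycleMetric (position x) (position y)

    graphDist-refl : ∀ x → graphDist x x ≡ 0
    graphDist-refl x with x ℕ.≟ x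
    ... | yes _   = refl
    ... | no  x≢x = contradiction refl x≢x

    graphDist-twins : ∀ {x y} → x ≢ y → position x ≡ position y → graphDist x y ≡ 2
    graphDist-twins {x} {y} x≢y px≡py with x ℕ.≟ y | position x ℕ.≟ position y
    ... | yes x≡y | _         = contradiction x≡y x≢y
    ... | no  _   | yes _     = refl
    ... | no  _   | no  px≢py = contradiction px≡py px≢py

    graphDist-apart : ∀ x y → position x ≢ position y → graphDist x y ≡ cycleMetric (position x) (position y)
    graphDist-apart x y px≢py with x ℕ.≟ y | position x ℕ.≟ position y
    ... | yes refl | _        = contradiction refl px≢py
    ... | no  _    | yes px≡py = contradiction px≡py px≢py
    ... | no  _    | no  _     = refl

    cycleMetric≤graphDist : ∀ x y → cycleMetric (position x) (position y) ≤ graphDist x y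
    cycleMetric≤graphDist x y with x ℕ.≟ y | position x ℕ.≟ position y
    ... | yes refl | _         = ℕP.≤-reflexive (cycleMetric-refl (position x))
    ... | no  _    | yes px≡py = subst (_≤ 2) (sym (trans (cong (cycleMetric (position x)) (sym px≡py)) (cycleMetric-refl (position x)))) z≤n
    ... | no  _    | no  _     = ℕP.≤-refl

    twins-at-0 : ∀ x y → x < N → y < N → x ≢ y → position x ≡ position y → position x ≡ 0
    twins-at-0 x y x<N y<N x≢y px≡py with position x ℕ.≟ 0
    ... | yes px≡0 = px≡0
    ... | no  px≢0 = contradiction (trans (position-determines x x<N px≢0)
                                    (trans (cong vertexAt px≡py) (sym (position-determines y y<N (px≢0 ∘ trans px≡py))))) x≢y

    graphDist≡0⇒≡ : ∀ x y → x < N → y < N → graphDist x y ≡ 0 → x ≡ y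
    graphDist≡0⇒≡ x y x<N y<N d≡0 with x ℕ.≟ y | position x ℕ.≟ position y
    ... | yes x≡y | _        = x≡y
    ... | no  _   | yes _    = contradiction d≡0 (λ ())
    ... | no  _   | no px≢py = contradiction d≡0
          (ℕP.<⇒≢ (cycleMetric-positive (position x) (position y) px≢py (position-≤ x x<N) (position-≤ y y<N)) ∘ sym)

    graphDist-edge : ∀ x y z → x < N → y < N → z < N → T (adjacent es x z) → graphDist x y ≤ suc (graphDist z y)
    graphDist-edge x y z x<N y<N z<N xz with x ℕ.≟ y | position x ℕ.≟ position y
    ... | yes _   | _     = z≤n
    ... | no  _   | yes px≡py = s≤s (ℕP.≤-trans (cycleMetric-positive (position z) (position y) pz≢py (position-≤ z z<N) (position-≤ y y<N))
                                                (cycleMetric≤graphDist z y))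
      where
      pz≢py : position z ≢ position y
      pz≢py pz≡py = CycleAdjacent-irreflexive c≢0 (position x)
                      (subst (CycleAdjacent (position x)) (trans pz≡py (sym px≡py)) (adjacent⇒cycleAdjacent x z xz))
    ... | no  _   | no  _ = ℕP.≤-trans (cycleMetric-adjacent (position x) (position z) (position y) (adjacent⇒cycleAdjacent x z xz) (position-≤ y y<N))
                                      (s≤s (cycleMetric≤graphDist z y))

    1≤k : 1 ≤ k
    1≤k = ℕP.n≢0⇒n>0 (λ k≡0 → c≢0 (cong (λ k → k + k) k≡0))

    graphDist-step : ∀ x y e → x < N → y < N → graphDist x y ≡ suc e → ∃[ z ] z < N × T (adjacent es x z) × graphDist z y ≡ e
    graphDist-step x y e x<N y<N d≡ with x ℕ.≟ y | position x ℕ.≟ position y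
    ... | yes _   | _         = contradiction d≡ (λ ())
    ... | no  x≢y | yes px≡py =
      2 , s≤s (s≤s (s≤s z≤n)) , successor-adjacent x 2 x<N (s≤s (s≤s (s≤s z≤n))) (cong suc (sym px≡0)) ,
      trans (graphDist-apart 2 y (λ 1≡py → ℕP.1+n≢0 (trans 1≡py py≡0)))
            (trans (cong (cycleMetric 1) py≡0) (trans (offsetDist-≤k 1 1≤k) (ℕP.suc-injective d≡)))
      where
      px≡0 : position x ≡ 0
      px≡0 = twins-at-0 x y x<N y<N x≢y px≡py
      py≡0 : position y ≡ 0
      py≡0 = trans (sym px≡py) px≡0
    ... | no  x≢y | no  px≢py with cycleMetric-descent (position x) (position y) (position-≤ x x<N) (position-≤ y y<N) px≢py
    ...   | b , b≤c , adj , cm≡ with b ℕ.≟ position y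
    ...     | yes b≡py = y , y<N , cycleAdjacent⇒adjacent x y x<N y<N (subst (CycleAdjacent (position x)) b≡py adj) ,
                         trans (graphDist-refl y)
                               (trans (sym (cycleMetric-refl (position y)))
                                      (trans (cong (λ z → cycleMetric z (position y)) (sym b≡py)) (ℕP.suc-injective (trans (sym cm≡) d≡))))
    ...     | no  b≢py = vertexAt b , vertexAt-< b ,
                         cycleAdjacent⇒adjacent x (vertexAt b) x<N (vertexAt-< b) (subst (CycleAdjacent (position x)) (sym pb) adj) ,
                         trans (graphDist-apart (vertexAt b) y (b≢py ∘ trans (sym pb)))
                               (trans (cong (λ z → cycleMetric z (position y)) pb) (ℕP.suc-injective (trans (sym cm≡) d≡)))
      where
      pb : position (vertexAt b) ≡ b
      pb = position-vertexAt b b≤c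

    graphDist-≤N : ∀ x y → graphDist x y ≤ N
    graphDist-≤N x y with x ℕ.≟ y | position x ℕ.≟ position y
    ... | yes _ | _     = z≤n
    ... | no  _ | yes _ = s≤s (s≤s z≤n)
    ... | no  _ | no  _ = ℕP.≤-trans (offsetDist-≤ _) (ℕP.≤-trans (ℕP.m≤m+n k k) (ℕP.≤-trans (ℕP.≤-reflexive c≡)
                            (s≤s (s≤s (s≤s (ℕP.≤-trans (ℕP.n≤1+n K₁) (ℕP.m≤n+m (suc K₁) R)))))))

    distMatrixC≡graphDist : ∀ (x y : Fin (numVertices 2 ms)) → distMatrixC 2 ms x y ≡ + graphDist (toℕ x) (toℕ y)
    distMatrixC≡graphDist = λ x y → cong +_ (distance≡ x y)
      where
      V : Set
      V = Fin (numVertices 2 ms)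
      d : V → V → ℕ
      d x y = graphDist (toℕ x) (toℕ y)
      <N : ∀ (x : V) → toℕ x < N
      <N x = subst (toℕ x <_) numVertices≡N (toℕ<n x)
      step : ∀ x y e → d x y ≡ suc e → ∃[ z ] T (adjC 2 ms x z) × d z y ≡ e
      step x y e d≡ with graphDist-step (toℕ x) (toℕ y) e (<N x) (<N y) d≡
      ... | z , z<N , xz , dzy = fromℕ< z<N′ , subst (T ∘ adjacent es (toℕ x)) (sym (toℕ-fromℕ< z<N′)) xz ,
                                 subst (λ w → graphDist w (toℕ y) ≡ e) (sym (toℕ-fromℕ< z<N′)) dzy
        where
        z<N′ : z < numVertices 2 ms
        z<N′ = subst (z <_) (sym numVertices≡N) z<N
      open DistanceCharacterisation (adjC 2 ms) d
        (λ x y d≡0 → toℕ-injective (graphDist≡0⇒≡ (toℕ x) (toℕ y) (<N x) (<N y) d≡0))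
        (λ x → graphDist-refl (toℕ x))
        (λ x y z → graphDist-edge (toℕ x) (toℕ y) (toℕ z) (<N x) (<N y) (<N z))
        step
        (λ x y → subst (graphDist (toℕ x) (toℕ y) ≤_) (sym numVertices≡N) (graphDist-≤N (toℕ x) (toℕ y)))

module DistanceMatrixDeterminant where

  open import Defs
  open Determinant
  open IndexedDeterminant
  open CycleMatrixDeterminant
  open TwinElimination
  open OddCycleMetric
  open StrideOrdering
  open TwinGraphDistance
  open import Data.Nat as ℕ using (ℕ; suc; _<_; _≤_; s≤s; _+_; _∸_; ∣_-_∣; _⊓_)
  import Data.Nat.Properties as ℕP
  open import Data.Fin using (Fin; toℕ; fromℕ<)
  open import Data.Fin.Properties using (toℕ<n; toℕ-fromℕ<; toℕ-injective)
  open import Data.Integer using (ℤ; +_; -_; _-_; _*_; _^_)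
  open import Data.Sum as Sum using (_⊎_; inj₁; inj₂)
  open import Function using (_∘_)
  open import Relation.Nullary using (Dec; yes; no)
  open import Relation.Nullary.Negation using (contradiction)
  open import Relation.Binary.PropositionalEquality
  open ≡-Reasoning

  module Reordering (k R K₁ : ℕ) (k+k≡ : k + k ≡ suc (suc (suc K₁))) where
    open OddCycle k
    open Stride k
    open TwinGraph k R K₁ k+k≡

    size : ℕ
    size = R + suc c

    N≡size : N ≡ size
    N≡size = trans (sym (trans (ℕP.+-suc R _) (cong suc (trans (ℕP.+-suc R _) (cong suc (ℕP.+-suc R _))))))
                   (cong (λ z → R + suc z) (sym k+k≡))

    -- Ordered indices 0..c run through the big cycle in steps of k; indices beyond c are the twins of u₁.
    reorder : ℕ → ℕ
    reorder s with s ℕ.≤? c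
    ... | yes _ = vertexAt (orderedPosition s)
    ... | no  _ = 3 + (s ∸ suc c)

    reorder-≤ : ∀ s → s ≤ c → reorder s ≡ vertexAt (orderedPosition s)
    reorder-≤ s s≤c with s ℕ.≤? c
    ... | yes _   = refl
    ... | no  s≰c = contradiction s≤c s≰c

    reorder-> : ∀ s → c < s → reorder s ≡ 3 + (s ∸ suc c)
    reorder-> s c<s with s ℕ.≤? c
    ... | yes s≤c = contradiction s≤c (ℕP.<⇒≱ c<s)
    ... | no  _   = refl

    reorder-c : reorder c ≡ 1
    reorder-c = trans (reorder-≤ c ℕP.≤-refl) (cong vertexAt orderedPosition-c)

    twinIndex< : ∀ s → s < size → c < s → s ∸ suc c < R
    twinIndex< s s<size c<s = ℕP.+-cancelʳ-< (suc c) (s ∸ suc c) R (subst (_< R + suc c) (sym (ℕP.m∸n+n≡m c<s)) s<size)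

    reorder-< : ∀ s → s < size → reorder s < N
    reorder-< s s<size with s ℕ.≤? c
    ... | yes _   = vertexAt-< (orderedPosition s)
    ... | no  s≰c = s≤s (s≤s (s≤s (ℕP.<-≤-trans (twinIndex< s s<size (ℕP.≰⇒> s≰c)) (ℕP.m≤m+n R (suc K₁)))))

    position-reorder : ∀ s → s < size → position (reorder s) ≡ orderedPosition (s ⊓ c)
    position-reorder s s<size with s ℕ.≤? c
    ... | yes s≤c = trans (position-vertexAt (orderedPosition s) (orderedPosition-≤ s)) (cong orderedPosition (sym (ℕP.m≤n⇒m⊓n≡m s≤c)))
    ... | no  s≰c = trans (position-twin (s ∸ suc c) (twinIndex< s s<size (ℕP.≰⇒> s≰c)))
                          (trans (sym orderedPosition-c) (cong orderedPosition (sym (ℕP.m≥n⇒m⊓n≡n (ℕP.<⇒≤ (ℕP.≰⇒> s≰c))))))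

    ⊓c-injective : ∀ {s t} → s < c → s ⊓ c ≡ t ⊓ c → s ≡ t
    ⊓c-injective {s} {t} s<c eq with t ℕ.<? c
    ... | yes t<c = trans (sym (ℕP.m≤n⇒m⊓n≡m (ℕP.<⇒≤ s<c))) (trans eq (ℕP.m≤n⇒m⊓n≡m (ℕP.<⇒≤ t<c)))
    ... | no  t≮c = contradiction (trans (sym (ℕP.m≤n⇒m⊓n≡m (ℕP.<⇒≤ s<c))) (trans eq (ℕP.m≥n⇒m⊓n≡n (ℕP.≮⇒≥ t≮c))))
                                  (ℕP.<⇒≢ s<c)

    reorder-sameClass : ∀ s t → s < size → t < size → reorder s ≡ reorder t → s ⊓ c ≡ t ⊓ c
    reorder-sameClass s t s<size t<size eq = orderedPosition-injective (s ⊓ c) (t ⊓ c) (ℕP.m⊓n≤n s c) (ℕP.m⊓n≤n t c)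
      (trans (sym (position-reorder s s<size)) (trans (cong position eq) (position-reorder t t<size)))

    reorder-injective : ∀ s t → s < size → t < size → reorder s ≡ reorder t → s ≡ t
    reorder-injective s t s<size t<size eq with <⊎≥ s c | <⊎≥ t c
    ... | inj₁ s<c | _        = ⊓c-injective s<c (reorder-sameClass s t s<size t<size eq)
    ... | inj₂ _   | inj₁ t<c = sym (⊓c-injective t<c (sym (reorder-sameClass s t s<size t<size eq)))
    ... | inj₂ c≤s | inj₂ c≤t with s ℕ.≟ c | t ℕ.≟ c
    ...   | yes s≡c | yes t≡c = trans s≡c (sym t≡c)
    ...   | yes refl | no t≢c = contradiction (trans (sym reorder-c) (trans eq (reorder-> t (ℕP.≤∧≢⇒< c≤t (t≢c ∘ sym))))) (λ ())
    ...   | no s≢c | yes refl = contradiction (trans (sym (reorder-> s (ℕP.≤∧≢⇒< c≤s (s≢c ∘ sym)))) (trans eq reorder-c)) (λ ())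
    ...   | no s≢c | no t≢c   = ℕP.∸-cancelʳ-≡ c<s c<t
                                  (ℕP.suc-injective (ℕP.suc-injective (ℕP.suc-injective (trans (sym (reorder-> s c<s)) (trans eq (reorder-> t c<t))))))
      where
      c<s : c < s
      c<s = ℕP.≤∧≢⇒< c≤s (s≢c ∘ sym)
      c<t : c < t
      c<t = ℕP.≤∧≢⇒< c≤t (t≢c ∘ sym)

    graphDist-reorder-cycle : ∀ s t → s < size → t < size → (s < c) ⊎ (t < c) →
      + graphDist (reorder s) (reorder t) ≡ cycleMatrix k (s ⊓ c) (t ⊓ c)
    graphDist-reorder-cycle s t s<size t<size s<c⊎t<c = by-position (position (reorder s) ℕ.≟ position (reorder t))
      where
      by-position : Dec (position (reorder s) ≡ position (reorder t)) → + graphDist (reorder s) (reorder t) ≡ cycleMatrix k (s ⊓ c) (t ⊓ c)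
      by-position (yes same) = trans (cong (λ u → + graphDist (reorder s) (reorder u)) (sym s≡t))
                               (trans (cong +_ (graphDist-refl (reorder s)))
                               (trans (sym (cong (cycDist k) (ℕP.∣n-n∣≡0 (s ⊓ c)))) (cong (cycleMatrix k (s ⊓ c) ∘ (_⊓ c)) s≡t)))
        where
        sameClass : s ⊓ c ≡ t ⊓ c
        sameClass = orderedPosition-injective (s ⊓ c) (t ⊓ c) (ℕP.m⊓n≤n s c) (ℕP.m⊓n≤n t c)
                      (trans (sym (position-reorder s s<size)) (trans same (position-reorder t t<size)))
        s≡t : s ≡ t
        s≡t = Sum.[ (λ s<c → ⊓c-injective s<c sameClass) , (λ t<c → sym (⊓c-injective t<c (sym sameClass))) ]′ s<c⊎t<c
      by-position (no differ) = begin
        + graphDist (reorder s) (reorder t)                            ≡⟨ cong +_ (graphDist-apart (reorder s) (reorder t) differ) ⟩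
        + cycleMetric (position (reorder s)) (position (reorder t))    ≡⟨ cong₂ (λ a b → + cycleMetric a b) (position-reorder s s<size) (position-reorder t t<size) ⟩
        + cycleMetric (orderedPosition (s ⊓ c)) (orderedPosition (t ⊓ c)) ≡⟨ cycleMetric-ordered (s ⊓ c) (t ⊓ c) (ℕP.m⊓n≤n s c) (ℕP.m⊓n≤n t c) ⟩
        cycleMatrix k (s ⊓ c) (t ⊓ c)                                 ∎

    graphDist-reorder : ∀ s t → s < size → t < size → + graphDist (reorder s) (reorder t) ≡ withTwins k c s t
    graphDist-reorder s t s<size t<size with <⊎≥ s c | <⊎≥ t c
    ... | inj₁ s<c | _ = trans (graphDist-reorder-cycle s t s<size t<size (inj₁ s<c)) (sym (withTwins-rowCycle k c s t s<c))
    ... | inj₂ _ | inj₁ t<c = trans (graphDist-reorder-cycle s t s<size t<size (inj₂ t<c)) (sym (withTwins-columnCycle k c s t t<c))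
    ... | inj₂ c≤s | inj₂ c≤t = by-identity (s ℕ.≟ t)
      where
      by-identity : Dec (s ≡ t) → + graphDist (reorder s) (reorder t) ≡ withTwins k c s t
      by-identity (yes refl) = trans (cong +_ (graphDist-refl (reorder s))) (sym (trans (withTwins-twins k c s s c≤s c≤s) (twinDist-refl s)))
      by-identity (no  s≢t)  = trans (cong +_ (graphDist-twins (s≢t ∘ reorder-injective s t s<size t<size) samePosition))
                                     (sym (trans (withTwins-twins k c s t c≤s c≤t) (twinDist-≢ s≢t)))
        where
        samePosition : position (reorder s) ≡ position (reorder t)
        samePosition = trans (position-reorder s s<size)
                       (trans (cong orderedPosition (trans (ℕP.m≥n⇒m⊓n≡n c≤s) (sym (ℕP.m≥n⇒m⊓n≡n c≤t))))
                              (sym (position-reorder t t<size)))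

    reorderFin : Fin size → Fin size
    reorderFin i = fromℕ< (subst (reorder (toℕ i) <_) N≡size (reorder-< (toℕ i) (toℕ<n i)))

    toℕ-reorderFin : ∀ i → toℕ (reorderFin i) ≡ reorder (toℕ i)
    toℕ-reorderFin i = toℕ-fromℕ< _

    reorderFin-injective : ∀ {i j} → reorderFin i ≡ reorderFin j → i ≡ j
    reorderFin-injective {i} {j} eq = toℕ-injective (reorder-injective (toℕ i) (toℕ j) (toℕ<n i) (toℕ<n j)
      (trans (sym (toℕ-reorderFin i)) (trans (cong toℕ eq) (toℕ-reorderFin j))))

    det-distanceMatrix : det (numVertices 2 ms) (distMatrixC 2 ms)
      ≡ (- + 2) ^ R * ((+ 1 Data.Integer.+ + R) * detℕ (suc c) (cycleMatrix k) Data.Integer.+ (+ 0 Data.Integer.+ + 2 * + R) * detℕ c (cycleMatrix k))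
    det-distanceMatrix = begin
      det (numVertices 2 ms) (distMatrixC 2 ms)
        ≡⟨ det-cong (numVertices 2 ms) {distMatrixC 2 ms} {toMatrix (numVertices 2 ms) D} distMatrixC≡graphDist ⟩
      detℕ (numVertices 2 ms) D
        ≡⟨ cong (λ n → detℕ n D) (trans numVertices≡N N≡size) ⟩
      detℕ size D
        ≡⟨ det-conjugate size reorderFin reorderFin-injective (toMatrix size D) ⟨
      det size (λ i j → D (toℕ (reorderFin i)) (toℕ (reorderFin j)))
        ≡⟨ det-cong size {λ i j → D (toℕ (reorderFin i)) (toℕ (reorderFin j))} {toMatrix size (withTwins k c)} (λ i j → trans (cong₂ D (toℕ-reorderFin i) (toℕ-reorderFin j))
                                        (graphDist-reorder (toℕ i) (toℕ j) (toℕ<n i) (toℕ<n j))) ⟩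
      detℕ (R + suc c) (withTwins k c)
        ≡⟨ det-withTwins k c R ⟩
      (- + 2) ^ R * ((+ 1 Data.Integer.+ + R) * detℕ (suc c) (cycleMatrix k) Data.Integer.+ (+ 0 Data.Integer.+ + 2 * + R) * detℕ c (cycleMatrix k)) ∎
      where
      D : ℕ → ℕ → ℤ
      D x y = + graphDist x y

    -- Stated for an arbitrary list equal to ms so that callers never have Agda unfold the determinant.
    det-distanceMatrix′ : ∀ ms′ → ms′ ≡ ms → det (numVertices 2 ms′) (distMatrixC 2 ms′)
      ≡ (- + 2) ^ R * ((+ 1 Data.Integer.+ + R) * detℕ (suc c) (cycleMatrix k) Data.Integer.+ (+ 0 Data.Integer.+ + 2 * + R) * detℕ c (cycleMatrix k))
    det-distanceMatrix′ _ refl = det-distanceMatrix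

open import Defs
open import Data.Nat using (ℕ; _≤_; _∸_)
import Data.Nat
open import Data.List using (replicate; _++_; _∷_; [])
open import Data.Integer using (ℤ; +_; -_; _*_; _-_; _^_; _+_)
open import Relation.Binary.PropositionalEquality using (_≡_)

open import Data.Nat using (suc; z≤n; s≤s)
import Data.Nat.Properties as ℕP
open import Data.Integer.Tactic.RingSolver using (solve-∀)
open import Relation.Binary.PropositionalEquality using (refl; sym; cong; cong₂; trans; module ≡-Reasoning)
open import Function using (_∘_)
open IndexedDeterminant using (detℕ)
open CycleMatrixDeterminant using (cycleMatrix; det-cycleMatrix-full; det-cycleMatrix-vertexDeleted)
open DistanceMatrixDeterminant using (module Reordering)

mainTheorem10 : (r k : ℕ) → 2 ≤ r → 2 ≤ k →
    det (numVertices 2 (replicate (r ∸ 1) 1 ++ (2 Data.Nat.* (k ∸ 1) ∷ [])))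
        (distMatrixC 2 (replicate (r ∸ 1) 1 ++ (2 Data.Nat.* (k ∸ 1) ∷ [])))
      ≡ ((- (+ 2)) ^ (r ∸ 1))
        * ((+ k) * (+ k + + 1) - (+ (r ∸ 1)) * (+ 3 * (+ k) * (+ k) - + k - + 2))
mainTheorem10 (suc (suc r)) (suc (suc a)) (s≤s (s≤s z≤n)) (s≤s (s≤s z≤n)) = begin
  det (numVertices 2 (replicate (suc (suc r) ∸ 1) 1 ++ (2 Data.Nat.* (suc (suc a) ∸ 1) ∷ [])))
      (distMatrixC 2 (replicate (suc (suc r) ∸ 1) 1 ++ (2 Data.Nat.* (suc (suc a) ∸ 1) ∷ [])))
    ≡⟨ Reordering.det-distanceMatrix′ (suc (suc a)) (suc r) K₁ k+k≡ (replicate (suc (suc r) ∸ 1) 1 ++ (2 Data.Nat.* (suc (suc a) ∸ 1) ∷ [])) refl ⟩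
  (- + 2) ^ suc r * ((+ 1 + + suc r) * detℕ (suc c) (cycleMatrix (suc (suc a))) + (+ 0 + + 2 * + suc r) * detℕ c (cycleMatrix (suc (suc a))))
    ≡⟨ cong₂ (λ u v → (- + 2) ^ suc r * ((+ 1 + + suc r) * u + (+ 0 + + 2 * + suc r) * v))
             (det-cycleMatrix-full (suc a)) (det-cycleMatrix-vertexDeleted (suc a)) ⟩
  (- + 2) ^ suc r * ((+ 1 + + suc r) * (k * (k + + 1)) + (+ 0 + + 2 * + suc r) * (+ 1 - + 2 * (k * k)))
    ≡⟨ collect ((- + 2) ^ suc r) (+ suc r) k ⟩
  (- + 2) ^ suc r * (k * (k + + 1) - + suc r * (+ 3 * k * k - k - + 2)) ∎
  where
  open ≡-Reasoning
  -- Chosen so that suc K₁ and 2 * (k ∸ 1) agree by computation.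
  K₁ : ℕ
  K₁ = a Data.Nat.+ (suc a Data.Nat.+ 0)
  k : ℤ
  k = + suc (suc a)
  k+k≡ : suc (suc a) Data.Nat.+ suc (suc a) ≡ suc (suc (suc K₁))
  k+k≡ = cong (suc ∘ suc) (trans (ℕP.+-suc a (suc a)) (cong (suc ∘ (a Data.Nat.+_)) (sym (ℕP.+-identityʳ (suc a)))))
  c : ℕ
  c = suc (suc a) Data.Nat.+ suc (suc a)
  collect : ∀ s R k → s * ((+ 1 + R) * (k * (k + + 1)) + (+ 0 + + 2 * R) * (+ 1 - + 2 * (k * k)))
                    ≡ s * (k * (k + + 1) - R * (+ 3 * k * k - k - + 2))
  collect = solve-∀
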